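{- Let $\mathbb{T}_2$ (over $\Sigma_2$) be a Morita extension of the coherent theory $\mathbb{T}_1$ (over $\Sigma_1\subseteq\Sigma_2$), and let $J_2$ be the coherent topology on $\mathcal{C}_{\mathbb{T}_2}$. Then for every object $\{\vec y.\psi\}$ of $\mathcal{C}_{\mathbb{T}_2}$ there is a $J_2$-covering sieve on $\{\vec y.\psi\}$ generated by morphisms all of whose domains lie in (the image of) $\mathcal{C}_{\mathbb{T}_1}$, i.e. are of the form $\{\vec z.\chi\}$ with $\chi$ a coherent $\Sigma_1$-formula and $\vec z$ variables of sorts in $\Sigma_1$.
   Context: For a coherent theory $\mathbb{T}$ over $\Sigma$, the syntactic category $\mathcal{C}_\mathbb{T}$ has objects the coherent formulas-in-context $\{\vec x.\phi\}$ up to renaming of variables, and morphisms $[\theta]:\{\vec x.\phi\}\to\{\vec y.\psi\}$ the $\mathbb{T}$-provable equivalence classes of $\mathbb{T}$-provably functional relations $\theta(\vec x,\vec y)$. $\mathcal{C}_{\mathbb{T}_1}$ is regarded as a full subcategory of $\mathcal{C}_{\mathbb{T}_2}$ via $\{\vec x.\phi\}\mapsto\{\vec x.\phi\}$, $[\theta]\mapsto[\theta]$. The coherent topology is generated by finite families $\{[\theta_k]:\{\vec x_k.\phi_k\}\to\{\vec y.\psi\}\}$ with $\mathbb{T}\models\psi\vdash\bigvee_k\exists\vec x_k\,\theta_k$. $\mathbb{T}_2$ is a Morita extension of $\mathbb{T}_1$ if it consists of $\mathbb{T}_1$ together with, for each symbol of $\Sigma_2\setminus\Sigma_1$, defining sequents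 of one of the kinds (new sorts built only from sorts $S$ with $\mathbb{T}_1\models\top\vdash\exists x{:}S\,(\top)$): (a) $f(\vec x)=y\dashv\vdash\phi(\vec x,y)$ with $\phi$ a $\mathbb{T}_1$-provably functional coherent $\Sigma_1$-formula, or $R(\vec x)\dashv\vdash\phi(\vec x)$; (b) product sort $S_1\times\dots\times S_n$ with projections $\pi_i$: $\top\vdash\exists x\,(\bigwedge_i\pi_i(x)=x_i)$ and $\bigwedge_i\pi_i(x)=x_i\wedge\bigwedge_i\pi_i(z)=x_i\vdash x=z$; (c) coproduct sort $S_1\amalg\dots\amalg S_n$ with injections $\rho_i$: $\top\vdash_x\bigvee_i\exists x_i\,(\rho_i(x_i)=x)$, $\rho_i(x_i)=x\wedge\rho_i(x_i')=x\vdash x_i=x_i'$, $\rho_i(x_i)=x\wedge\rho_j(x_j)=x\vdash\bot$ ($i\ne j$); (d) subsort $S$ of $T$ via coherent $\Sigma_1$-formula $\phi$ (possibly $\bot$) and $i:S\to T$: $\phi(x)\dashv\vdash_{x:T}\exists y{:}S\,(i(y)=x)$, $i(x)=i(y)\vdash x=y$; (e) quotient sort $S$ of $T$ by a $\mathbb{T}_1$-provable equivalence relation $\phi$ with $\epsilon:T\to S$: $\epsilon(x)=\epsilon(y)\dashv\vdash\phi(x,y)$, $\top\vdash_{x:S}\exists y\,(\epsilon(y)=x)$. -}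

module Defs where

open import Data.List using (List; []; _∷_; _++_; map)
open import Data.Nat using (ℕ; zero; suc)
open import Data.Fin using (Fin; zero; suc)
open import Data.Sum using (_⊎_; inj₁; inj₂)
open import Data.Product using (_×_; _,_)
open import Relation.Binary.PropositionalEquality using (_≡_)
open import Relation.Nullary using (¬_)

infix 4 _∋_
data _∋_ {A : Set} : List A → A → Set where
  here  : ∀ {a as} → (a ∷ as) ∋ a
  there : ∀ {a b as} → as ∋ a → (b ∷ as) ∋ a

index : ∀ {A : Set} {as : List A} {a} → as ∋ a → ℕ
index here      = zero
index (there v) = suc (index v)

Ren : {A : Set} → List A → List A → Set
Ren Γ Δ = ∀ {a} → Γ ∋ a → Δ ∋ a

inl : ∀ {A : Set} {Γ Δ : List A} → Ren Γ (Γ ++ Δ)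
inl here      = here
inl (there v) = there (inl v)

inr : ∀ {A : Set} (Γ : List A) {Δ : List A} → Ren Δ (Γ ++ Δ)
inr []      v = v
inr (_ ∷ Γ) v = there (inr Γ v)

split : ∀ {A : Set} (Γ : List A) {Δ : List A} {a} → (Γ ++ Δ) ∋ a → (Γ ∋ a) ⊎ (Δ ∋ a)
split []      v         = inj₂ v
split (_ ∷ Γ) here      = inj₁ here
split (_ ∷ Γ) (there v) with split Γ v
... | inj₁ w = inj₁ (there w)
... | inj₂ w = inj₂ w

copair : ∀ {A : Set} (Γ : List A) {Δ Θ : List A} → Ren Γ Θ → Ren Δ Θ → Ren (Γ ++ Δ) Θ
copair Γ f g v with split Γ v
... | inj₁ w = f w
... | inj₂ w = g w

swap : ∀ {A : Set} (Γ Δ : List A) → Ren (Γ ++ Δ) (Δ ++ Γ)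
swap Γ Δ = copair Γ (inr Δ) inl

mapVar : ∀ {A B : Set} (f : A → B) {as : List A} {a : A} → as ∋ a → map f as ∋ f a
mapVar f here      = here
mapVar f (there v) = there (mapVar f v)

record Signature : Set₁ where
  field
    Sort : Set
    Fun  : Set
    Rel  : Set
    fdom : Fun → List Sort
    fcod : Fun → Sort
    rdom : Rel → List Sort

-- Coherent syntax and the coherent sequent calculus (Johnstone D1.3.1)
-- over a signature.  Formulas-in-context {Γ . φ} are  φ : Formula Γ
-- (de Bruijn: the head of Γ is the most recently bound variable).

module Syntax (sig : Signature) where
  open Signature sig

  Ctx : Set
  Ctx = List Sort

  data Term (Γ : Ctx) : Sort → Set
  data Terms (Γ : Ctx) : List Sort → Set

  data Term Γ where
    var : ∀ {S} → Γ ∋ S → Term Γ S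
    app : (f : Fun) → Terms Γ (fdom f) → Term Γ (fcod f)

  data Terms Γ where
    []  : Terms Γ []
    _∷_ : ∀ {S ss} → Term Γ S → Terms Γ ss → Terms Γ (S ∷ ss)

  infix  6 _≐_
  infixr 5 _∧'_
  infixr 4 _∨'_

  data Formula (Γ : Ctx) : Set where
    ⊤'   : Formula Γ
    ⊥'   : Formula Γ
    rel  : (R : Rel) → Terms Γ (rdom R) → Formula Γ
    _≐_  : ∀ {S} → Term Γ S → Term Γ S → Formula Γ
    _∧'_ : Formula Γ → Formula Γ → Formula Γ
    _∨'_ : Formula Γ → Formula Γ → Formula Γ
    ∃'   : ∀ {S} → Formula (S ∷ Γ) → Formula Γ

  ext : ∀ {Γ Δ : Ctx} {S : Sort} → Ren Γ Δ → Ren (S ∷ Γ) (S ∷ Δ)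
  ext r here      = here
  ext r (there v) = there (r v)

  renT  : ∀ {Γ Δ S} → Ren Γ Δ → Term Γ S → Term Δ S
  renTs : ∀ {Γ Δ ss} → Ren Γ Δ → Terms Γ ss → Terms Δ ss
  renT r (var v)    = var (r v)
  renT r (app f ts) = app f (renTs r ts)
  renTs r []       = []
  renTs r (t ∷ ts) = renT r t ∷ renTs r ts

  renF : ∀ {Γ Δ} → Ren Γ Δ → Formula Γ → Formula Δ
  renF r ⊤'         = ⊤'
  renF r ⊥'         = ⊥'
  renF r (rel R ts) = rel R (renTs r ts)
  renF r (s ≐ t)    = renT r s ≐ renT r t
  renF r (φ ∧' ψ)   = renF r φ ∧' renF r ψ
  renF r (φ ∨' ψ)   = renF r φ ∨' renF r ψ
  renF r (∃' φ)     = ∃' (renF (ext r) φ)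

  wk : ∀ {Γ S} → Formula Γ → Formula (S ∷ Γ)
  wk = renF there

  Sub : Ctx → Ctx → Set
  Sub Γ Δ = ∀ {S} → Γ ∋ S → Term Δ S

  exts : ∀ {Γ Δ : Ctx} {S : Sort} → Sub Γ Δ → Sub (S ∷ Γ) (S ∷ Δ)
  exts σ here      = var here
  exts σ (there v) = renT there (σ v)

  subT  : ∀ {Γ Δ S} → Sub Γ Δ → Term Γ S → Term Δ S
  subTs : ∀ {Γ Δ ss} → Sub Γ Δ → Terms Γ ss → Terms Δ ss
  subT σ (var v)    = σ v
  subT σ (app f ts) = app f (subTs σ ts)
  subTs σ []       = []
  subTs σ (t ∷ ts) = subT σ t ∷ subTs σ ts

  subF : ∀ {Γ Δ} → Sub Γ Δ → Formula Γ → Formula Δ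
  subF σ ⊤'         = ⊤'
  subF σ ⊥'         = ⊥'
  subF σ (rel R ts) = rel R (subTs σ ts)
  subF σ (s ≐ t)    = subT σ s ≐ subT σ t
  subF σ (φ ∧' ψ)   = subF σ φ ∧' subF σ ψ
  subF σ (φ ∨' ψ)   = subF σ φ ∨' subF σ ψ
  subF σ (∃' φ)     = ∃' (subF (exts σ) φ)

  sub0 : ∀ {Γ S} → Term Γ S → Sub (S ∷ Γ) Γ
  sub0 t here      = t
  sub0 t (there v) = var v

  record Theory : Set₁ where
    field
      Ax : (Γ : Ctx) → Formula Γ → Formula Γ → Set
  open Theory public

  data Pf (T : Theory) : (Γ : Ctx) → Formula Γ → Formula Γ → Set where
    axiom   : ∀ {Γ φ ψ} → Ax T Γ φ ψ → Pf T Γ φ ψ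
    idt     : ∀ {Γ φ} → Pf T Γ φ φ
    cut     : ∀ {Γ φ ψ χ} → Pf T Γ φ ψ → Pf T Γ ψ χ → Pf T Γ φ χ
    subst   : ∀ {Γ Δ φ ψ} (σ : Sub Γ Δ) → Pf T Γ φ ψ → Pf T Δ (subF σ φ) (subF σ ψ)
    eq-refl : ∀ {Γ S} (x : Γ ∋ S) → Pf T Γ ⊤' (var x ≐ var x)
    eq-subst : ∀ {Γ S} (s t : Term Γ S) (φ : Formula (S ∷ Γ)) →
               Pf T Γ ((s ≐ t) ∧' subF (sub0 s) φ) (subF (sub0 t) φ)
    top     : ∀ {Γ φ} → Pf T Γ φ ⊤'
    ∧-el₁   : ∀ {Γ φ ψ} → Pf T Γ (φ ∧' ψ) φ
    ∧-el₂   : ∀ {Γ φ ψ} → Pf T Γ (φ ∧' ψ) ψ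
    ∧-intro : ∀ {Γ φ ψ χ} → Pf T Γ φ ψ → Pf T Γ φ χ → Pf T Γ φ (ψ ∧' χ)
    bot     : ∀ {Γ φ} → Pf T Γ ⊥' φ
    ∨-in₁   : ∀ {Γ φ ψ} → Pf T Γ φ (φ ∨' ψ)
    ∨-in₂   : ∀ {Γ φ ψ} → Pf T Γ ψ (φ ∨' ψ)
    ∨-elim  : ∀ {Γ φ ψ χ} → Pf T Γ φ χ → Pf T Γ ψ χ → Pf T Γ (φ ∨' ψ) χ
    ∃-elim  : ∀ {Γ S} {φ : Formula (S ∷ Γ)} {ψ} → Pf T (S ∷ Γ) φ (wk ψ) → Pf T Γ (∃' φ) ψ
    ∃-unel  : ∀ {Γ S} {φ : Formula (S ∷ Γ)} {ψ} → Pf T Γ (∃' φ) ψ → Pf T (S ∷ Γ) φ (wk ψ)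
    dist    : ∀ {Γ φ ψ χ} → Pf T Γ (φ ∧' (ψ ∨' χ)) ((φ ∧' ψ) ∨' (φ ∧' χ))
    frob    : ∀ {Γ S φ} {ψ : Formula (S ∷ Γ)} → Pf T Γ (φ ∧' ∃' ψ) (∃' (wk φ ∧' ψ))

  PfEq : Theory → (Γ : Ctx) → Formula Γ → Formula Γ → Set
  PfEq T Γ φ ψ = Pf T Γ φ ψ × Pf T Γ ψ φ

  ⋀ : ∀ {Γ} {A : Set} (ss : List A) → (∀ {S} → ss ∋ S → Formula Γ) → Formula Γ
  ⋀ []       f = ⊤'
  ⋀ (S ∷ ss) f = f here ∧' ⋀ ss (λ v → f (there v))

  ⋁ₗ : ∀ {Γ} {A : Set} (ss : List A) → (∀ {S} → ss ∋ S → Formula Γ) → Formula Γ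
  ⋁ₗ []       f = ⊥'
  ⋁ₗ (S ∷ ss) f = f here ∨' ⋁ₗ ss (λ v → f (there v))

  ⋁ : ∀ {Γ} (n : ℕ) → (Fin n → Formula Γ) → Formula Γ
  ⋁ zero    f = ⊥'
  ⋁ (suc n) f = f zero ∨' ⋁ n (λ k → f (suc k))

  ∃* : ∀ {Γ} (ys : Ctx) → Formula (ys ++ Γ) → Formula Γ
  ∃* []       θ = θ
  ∃* (S ∷ ys) θ = ∃* ys (∃' θ)

  tab : ∀ {Γ} (ss : List Sort) → (∀ {S} → ss ∋ S → Term Γ S) → Terms Γ ss
  tab []       f = []
  tab (S ∷ ss) f = f here ∷ tab ss (λ v → f (there v))

  VarsEq : ∀ {Θ} (ys : Ctx) → Ren ys Θ → Ren ys Θ → Formula Θ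
  VarsEq ys r r' = ⋀ ys (λ v → var (r v) ≐ var (r' v))

  record ProvFun (T : Theory) {xs ys : Ctx} (φ : Formula xs) (ψ : Formula ys)
                 (θ : Formula (ys ++ xs)) : Set where
    field
      pf-graph  : Pf T (ys ++ xs) θ (renF (inr ys) φ ∧' renF inl ψ)
      pf-total  : Pf T xs φ (∃* ys θ)
      pf-unique : Pf T (ys ++ (ys ++ xs))
                    (renF (copair ys inl (λ v → inr ys (inr ys v))) θ ∧' renF (inr ys) θ)
                    (VarsEq ys inl (λ v → inr ys (inl v)))

  Inhabited : Theory → Sort → Set
  Inhabited T S = Pf T [] ⊤' (∃' {S = S} ⊤')

-- Data of a Morita extension of T1 (one new symbol family of each kind (a)–(e))

record MoritaData {Σ₁ : Signature} (T₁ : Syntax.Theory Σ₁) : Set₁ where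
  open Signature Σ₁
  open Syntax Σ₁
  field
    DefFun     : Set
    defFunDom  : DefFun → List Sort
    defFunCod  : DefFun → Sort
    defFunFml  : (f : DefFun) → Formula (defFunCod f ∷ defFunDom f)
    defFunFun  : (f : DefFun) → ProvFun T₁ {defFunDom f} {defFunCod f ∷ []} ⊤' ⊤' (defFunFml f)
    DefRel     : Set
    defRelDom  : DefRel → List Sort
    defRelFml  : (R : DefRel) → Formula (defRelDom R)
    ProdSort   : Set
    prodComps  : ProdSort → List Sort
    prodInh    : (p : ProdSort) {S : Sort} → prodComps p ∋ S → Inhabited T₁ S
    CoprodSort : Set
    coprodComps : CoprodSort → List Sort
    coprodInh  : (q : CoprodSort) {S : Sort} → coprodComps q ∋ S → Inhabited T₁ S
    SubSort    : Set
    subAmb     : SubSort → Sort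
    subFml     : (s : SubSort) → Formula (subAmb s ∷ [])
    subInh     : (s : SubSort) → Inhabited T₁ (subAmb s)
    -- (e) quotient sorts of T by a provable equivalence relation φ(x,y)
    --     (x the variable 'here', y the variable 'there here')
    QuotSort   : Set
    quotBase   : QuotSort → Sort
    quotFml    : (q : QuotSort) → Formula (quotBase q ∷ quotBase q ∷ [])
    quotInh    : (q : QuotSort) → Inhabited T₁ (quotBase q)
    quotRefl   : (q : QuotSort) →
                 Pf T₁ (quotBase q ∷ []) ⊤' (renF (λ { here → here ; (there here) → here }) (quotFml q))
    quotSym    : (q : QuotSort) →
                 Pf T₁ (quotBase q ∷ quotBase q ∷ []) (quotFml q)
                   (renF (λ { here → there here ; (there here) → here }) (quotFml q))
    quotTrans  : (q : QuotSort) →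
                 Pf T₁ (quotBase q ∷ quotBase q ∷ quotBase q ∷ [])
                   (renF (λ { here → here ; (there here) → there here }) (quotFml q) ∧'
                    renF (λ { here → there here ; (there here) → there (there here) }) (quotFml q))
                   (renF (λ { here → here ; (there here) → there (there here) }) (quotFml q))

module Ext {Σ₁ : Signature} {T₁ : Syntax.Theory Σ₁} (M : MoritaData T₁) where
  open MoritaData M
  module S₁ = Syntax Σ₁
  open Signature Σ₁ renaming (Sort to Sort₁; Fun to Fun₁; Rel to Rel₁;
                              fdom to fdom₁; fcod to fcod₁; rdom to rdom₁)

  data Sort₂ : Set where
    old    : Sort₁ → Sort₂
    prod   : ProdSort → Sort₂
    coprod : CoprodSort → Sort₂
    sub    : SubSort → Sort₂
    quot   : QuotSort → Sort₂

  data Fun₂ : Set where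
    oldF : Fun₁ → Fun₂
    defF : DefFun → Fun₂
    π    : (p : ProdSort) {S : Sort₁} → prodComps p ∋ S → Fun₂
    ρ    : (q : CoprodSort) {S : Sort₁} → coprodComps q ∋ S → Fun₂
    ι    : SubSort → Fun₂
    ε    : QuotSort → Fun₂

  data Rel₂ : Set where
    oldR : Rel₁ → Rel₂
    defR : DefRel → Rel₂

  fdom₂ : Fun₂ → List Sort₂
  fdom₂ (oldF f)  = map old (fdom₁ f)
  fdom₂ (defF f)  = map old (defFunDom f)
  fdom₂ (π p v)   = prod p ∷ []
  fdom₂ (ρ q {S} v) = old S ∷ []
  fdom₂ (ι s)     = sub s ∷ []
  fdom₂ (ε q)     = old (quotBase q) ∷ []

  fcod₂ : Fun₂ → Sort₂
  fcod₂ (oldF f)  = old (fcod₁ f)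
  fcod₂ (defF f)  = old (defFunCod f)
  fcod₂ (π p {S} v) = old S
  fcod₂ (ρ q v)   = coprod q
  fcod₂ (ι s)     = old (subAmb s)
  fcod₂ (ε q)     = quot q

  rdom₂ : Rel₂ → List Sort₂
  rdom₂ (oldR R) = map old (rdom₁ R)
  rdom₂ (defR R) = map old (defRelDom R)

  Σ₂ : Signature
  Σ₂ = record { Sort = Sort₂ ; Fun = Fun₂ ; Rel = Rel₂
              ; fdom = fdom₂ ; fcod = fcod₂ ; rdom = rdom₂ }

  module S₂ = Syntax Σ₂
  open S₂

  trT  : ∀ {Γ S} → S₁.Term Γ S → Term (map old Γ) (old S)
  trTs : ∀ {Γ ss} → S₁.Terms Γ ss → Terms (map old Γ) (map old ss)
  trT (S₁.var v)    = var (mapVar old v)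
  trT (S₁.app f ts) = app (oldF f) (trTs ts)
  trTs S₁.[]       = []
  trTs (t S₁.∷ ts) = trT t ∷ trTs ts

  tr : ∀ {Γ} → S₁.Formula Γ → Formula (map old Γ)
  tr S₁.⊤'         = ⊤'
  tr S₁.⊥'         = ⊥'
  tr (S₁.rel R ts) = rel (oldR R) (trTs ts)
  tr (s S₁.≐ t)    = trT s ≐ trT t
  tr (φ S₁.∧' ψ)   = tr φ ∧' tr ψ
  tr (φ S₁.∨' ψ)   = tr φ ∨' tr ψ
  tr (S₁.∃' φ)     = ∃' (tr φ)

  data Ax₂ : (Γ : Ctx) → Formula Γ → Formula Γ → Set where
    ax-old : ∀ {Γ : S₁.Ctx} {φ ψ : S₁.Formula Γ} → S₁.Ax T₁ Γ φ ψ → Ax₂ (map old Γ) (tr φ) (tr ψ)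
    -- (a) functions: f(x⃗) = y ⊣⊢ φ(x⃗,y)   in context  y, x⃗
    ax-fun₁ : (f : DefFun) →
      Ax₂ (old (defFunCod f) ∷ map old (defFunDom f))
          (app (defF f) (tab (map old (defFunDom f)) (λ v → var (there v))) ≐ var here)
          (tr (defFunFml f))
    ax-fun₂ : (f : DefFun) →
      Ax₂ (old (defFunCod f) ∷ map old (defFunDom f))
          (tr (defFunFml f))
          (app (defF f) (tab (map old (defFunDom f)) (λ v → var (there v))) ≐ var here)
    -- (a) relations: R(x⃗) ⊣⊢ φ(x⃗)
    ax-rel₁ : (R : DefRel) →
      Ax₂ (map old (defRelDom R)) (rel (defR R) (tab (map old (defRelDom R)) var)) (tr (defRelFml R))
    ax-rel₂ : (R : DefRel) →
      Ax₂ (map old (defRelDom R)) (tr (defRelFml R)) (rel (defR R) (tab (map old (defRelDom R)) var))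
    -- (b) products:  ⊤ ⊢_{x⃗} ∃x ⋀ᵢ πᵢ(x) = xᵢ
    ax-prod₁ : (p : ProdSort) →
      Ax₂ (map old (prodComps p)) ⊤'
          (∃' {S = prod p} (⋀ (prodComps p) (λ v →
              app (π p v) (var here ∷ []) ≐ var (there (mapVar old v)))))
    --   ⋀ᵢ πᵢ(x) = xᵢ ∧ ⋀ᵢ πᵢ(z) = xᵢ ⊢_{x,z,x⃗} x = z
    ax-prod₂ : (p : ProdSort) →
      Ax₂ (prod p ∷ prod p ∷ map old (prodComps p))
          (⋀ (prodComps p) (λ v → app (π p v) (var here ∷ []) ≐ var (there (there (mapVar old v))))
           ∧' ⋀ (prodComps p) (λ v → app (π p v) (var (there here) ∷ []) ≐ var (there (there (mapVar old v)))))
          (var here ≐ var (there here))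
    -- (c) coproducts:  ⊤ ⊢_x ⋁ᵢ ∃xᵢ ρᵢ(xᵢ) = x
    ax-coprod₁ : (q : CoprodSort) →
      Ax₂ (coprod q ∷ []) ⊤'
          (⋁ₗ (coprodComps q) (λ {S} v → ∃' {S = old S} (app (ρ q v) (var here ∷ []) ≐ var (there here))))
    --   ρᵢ(xᵢ) = x ∧ ρᵢ(xᵢ') = x ⊢_{xᵢ,xᵢ',x} xᵢ = xᵢ'
    ax-coprod₂ : (q : CoprodSort) {S : Sort₁} (v : coprodComps q ∋ S) →
      Ax₂ (old S ∷ old S ∷ coprod q ∷ [])
          ((app (ρ q v) (var here ∷ []) ≐ var (there (there here)))
           ∧' (app (ρ q v) (var (there here) ∷ []) ≐ var (there (there here))))
          (var here ≐ var (there here))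
    --   ρᵢ(xᵢ) = x ∧ ρⱼ(xⱼ) = x ⊢_{xᵢ,xⱼ,x} ⊥   (i ≠ j)
    ax-coprod₃ : (q : CoprodSort) {S S' : Sort₁} (v : coprodComps q ∋ S) (w : coprodComps q ∋ S') →
      ¬ (index v ≡ index w) →
      Ax₂ (old S ∷ old S' ∷ coprod q ∷ [])
          ((app (ρ q v) (var here ∷ []) ≐ var (there (there here)))
           ∧' (app (ρ q w) (var (there here) ∷ []) ≐ var (there (there here))))
          ⊥'
    -- (d) subsorts:  φ(x) ⊣⊢_{x:T} ∃y:S ι(y) = x ,   ι(x) = ι(y) ⊢_{x,y:S} x = y
    ax-sub₁ : (s : SubSort) →
      Ax₂ (old (subAmb s) ∷ []) (tr (subFml s))
          (∃' {S = sub s} (app (ι s) (var here ∷ []) ≐ var (there here)))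
    ax-sub₂ : (s : SubSort) →
      Ax₂ (old (subAmb s) ∷ [])
          (∃' {S = sub s} (app (ι s) (var here ∷ []) ≐ var (there here)))
          (tr (subFml s))
    ax-sub₃ : (s : SubSort) →
      Ax₂ (sub s ∷ sub s ∷ [])
          (app (ι s) (var here ∷ []) ≐ app (ι s) (var (there here) ∷ []))
          (var here ≐ var (there here))
    -- (e) quotients:  ε(x) = ε(y) ⊣⊢_{x,y:T} φ(x,y) ,   ⊤ ⊢_{x:S} ∃y ε(y) = x
    ax-quot₁ : (q : QuotSort) →
      Ax₂ (old (quotBase q) ∷ old (quotBase q) ∷ [])
          (app (ε q) (var here ∷ []) ≐ app (ε q) (var (there here) ∷ []))
          (tr (quotFml q))
    ax-quot₂ : (q : QuotSort) →
      Ax₂ (old (quotBase q) ∷ old (quotBase q) ∷ [])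
          (tr (quotFml q))
          (app (ε q) (var here ∷ []) ≐ app (ε q) (var (there here) ∷ []))
    ax-quot₃ : (q : QuotSort) →
      Ax₂ (quot q ∷ []) ⊤'
          (∃' {S = old (quotBase q)} (app (ε q) (var here ∷ []) ≐ var (there here)))

  T₂ : Theory
  T₂ = record { Ax = Ax₂ }

module Submission where

open import Defs
open import Data.List using (List; []; _∷_; _++_; map; length)
open import Data.Nat using (ℕ; zero; suc; pred; _*_)
open import Data.Fin using (Fin; zero; suc; remQuot; combine)
open import Data.Fin.Properties using (remQuot-combine)
open import Data.Product using (Σ; _×_; _,_; proj₁; proj₂)
open import Data.Sum using (inj₁; inj₂)
open import Relation.Nullary using (¬_)
open import Relation.Binary.PropositionalEquality using (_≡_; refl; sym; trans; cong; cong₂)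

-- An element of a new sort is represented by elements of old sorts: a product element by its
-- components, a coproduct element by an element of one summand, a subsort element by its image in
-- the ambient sort, a quotient element by a representative.  Every sort has finitely many such
-- branches (one per summand of a coproduct) and they jointly cover it.  Choosing a branch for each
-- variable of ys gives a Σ₁-context zs; translating ψ along the representations (new function and
-- relation symbols by their defining formulas, equality of new elements by equality of
-- representations, resp. the defining equivalence for quotients) gives a Σ₁-formula χ.  The
-- relation "zs represents ys, and ψ" is then T₂-provably functional from {zs . χ} to {ys . ψ},
-- because a representation determines what it represents, and its images over all choices of
-- branches cover ψ.

module _ {A : Set} where
  ++-ext : ∀ (L : List A) {Δ : List A} {C : A → Set} (f g : ∀ {S} → (L ++ Δ) ∋ S → C S) →
           (∀ {S} (e : L ∋ S) → f (inl e) ≡ g (inl e)) → (∀ {S} (z : Δ ∋ S) → f (inr L z) ≡ g (inr L z)) →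
           ∀ {S} (v : (L ++ Δ) ∋ S) → f v ≡ g v
  ++-ext [] f g p q v = q v
  ++-ext (x ∷ L) f g p q here = p here
  ++-ext (x ∷ L) f g p q (there v) = ++-ext L (λ w → f (there w)) (λ w → g (there w)) (λ e → p (there e)) q v

  split-inl : ∀ (Γ : List A) {Δ : List A} {a} (v : Γ ∋ a) → split Γ {Δ} (inl v) ≡ inj₁ v
  split-inl (x ∷ Γ) here = refl
  split-inl (x ∷ Γ) {Δ} (there v) rewrite split-inl Γ {Δ} v = refl

  split-inr : ∀ (Γ : List A) {Δ : List A} {a} (v : Δ ∋ a) → split Γ (inr Γ v) ≡ inj₂ v
  split-inr [] v = refl
  split-inr (x ∷ Γ) v rewrite split-inr Γ v = refl

  copair-inl : ∀ (Γ : List A) {Δ Θ : List A} (f : Ren Γ Θ) (g : Ren Δ Θ) {a} (v : Γ ∋ a) → copair Γ f g (inl v) ≡ f v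
  copair-inl Γ {Δ} f g v with split Γ {Δ} (inl v) | split-inl Γ {Δ} v
  ... | .(inj₁ v) | refl = refl

  copair-inr : ∀ (Γ : List A) {Δ Θ : List A} (f : Ren Γ Θ) (g : Ren Δ Θ) {a} (v : Δ ∋ a) → copair Γ f g (inr Γ v) ≡ g v
  copair-inr Γ f g v with split Γ (inr Γ v) | split-inr Γ v
  ... | .(inj₂ v) | refl = refl

  nthPos : (ss : List A) → Fin (length ss) → Σ A (λ S → ss ∋ S)
  nthPos (S ∷ ss) zero = S , here
  nthPos (S ∷ ss) (suc k) = proj₁ (nthPos ss k) , there (proj₂ (nthPos ss k))

  data Cmp {ss : List A} : ∀ {S S'} → ss ∋ S → ss ∋ S' → Set where
    same : ∀ {S} {v : ss ∋ S} → Cmp v v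
    diff : ∀ {S S'} {v : ss ∋ S} {w : ss ∋ S'} → ¬ (index v ≡ index w) → Cmp v w

  cmp : ∀ {ss : List A} {S S'} (v : ss ∋ S) (w : ss ∋ S') → Cmp v w
  cmp here here = same
  cmp here (there w) = diff (λ ())
  cmp (there v) here = diff (λ ())
  cmp (there v) (there w) with cmp v w
  ... | same = same
  ... | diff ne = diff (λ e → ne (cong pred e))

  pairRen : ∀ {Δ : List A} {S} → Δ ∋ S → Δ ∋ S → Ren (S ∷ S ∷ []) Δ
  pairRen a b here = a
  pairRen a b (there here) = b

  consRen : ∀ {Δ : List A} {S ss} → Δ ∋ S → (∀ {S'} → ss ∋ S' → Δ ∋ S') → ∀ {S'} → (S ∷ ss) ∋ S' → Δ ∋ S'
  consRen z ws here = z
  consRen z ws (there v) = ws v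

  emptyRen : ∀ {Δ : List A} {S} → [] ∋ S → Δ ∋ S
  emptyRen ()

  idRen : ∀ {Γ : List A} → Ren Γ Γ
  idRen v = v

module SyntaxProperties (sig : Signature) where
  open Signature sig
  open Syntax sig

  RenEq : ∀ {Γ Δ : Ctx} → Ren Γ Δ → Ren Γ Δ → Set
  RenEq {Γ} r r' = ∀ {S} (v : Γ ∋ S) → r v ≡ r' v

  SubEq : ∀ {Γ Δ : Ctx} → Sub Γ Δ → Sub Γ Δ → Set
  SubEq {Γ} r r' = ∀ {S} (v : Γ ∋ S) → r v ≡ r' v

  ext-cong : ∀ {Γ Δ S} {r r' : Ren Γ Δ} → RenEq r r' → RenEq (ext {S = S} r) (ext r')
  ext-cong e here = refl
  ext-cong e (there v) = cong there (e v)

  renT-cong : ∀ {Γ Δ S} {r r' : Ren Γ Δ} → RenEq r r' → (t : Term Γ S) → renT r t ≡ renT r' t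
  renTs-cong : ∀ {Γ Δ ss} {r r' : Ren Γ Δ} → RenEq r r' → (t : Terms Γ ss) → renTs r t ≡ renTs r' t
  renT-cong e (var v) = cong var (e v)
  renT-cong e (app f ts) = cong (app f) (renTs-cong e ts)
  renTs-cong e [] = refl
  renTs-cong e (t ∷ ts) = cong₂ _∷_ (renT-cong e t) (renTs-cong e ts)

  renF-cong : ∀ {Γ Δ} {r r' : Ren Γ Δ} → RenEq r r' → (φ : Formula Γ) → renF r φ ≡ renF r' φ
  renF-cong e ⊤' = refl
  renF-cong e ⊥' = refl
  renF-cong e (rel R ts) = cong (rel R) (renTs-cong e ts)
  renF-cong e (s ≐ t) = cong₂ _≐_ (renT-cong e s) (renT-cong e t)
  renF-cong e (φ ∧' ψ) = cong₂ _∧'_ (renF-cong e φ) (renF-cong e ψ)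
  renF-cong e (φ ∨' ψ) = cong₂ _∨'_ (renF-cong e φ) (renF-cong e ψ)
  renF-cong e (∃' φ) = cong ∃' (renF-cong (ext-cong e) φ)

  exts-cong : ∀ {Γ Δ S} {r r' : Sub Γ Δ} → SubEq r r' → SubEq (exts {S = S} r) (exts r')
  exts-cong e here = refl
  exts-cong e (there v) = cong (renT there) (e v)

  subT-cong : ∀ {Γ Δ S} {r r' : Sub Γ Δ} → SubEq r r' → (t : Term Γ S) → subT r t ≡ subT r' t
  subTs-cong : ∀ {Γ Δ ss} {r r' : Sub Γ Δ} → SubEq r r' → (t : Terms Γ ss) → subTs r t ≡ subTs r' t
  subT-cong e (var v) = e v
  subT-cong e (app f ts) = cong (app f) (subTs-cong e ts)
  subTs-cong e [] = refl
  subTs-cong e (t ∷ ts) = cong₂ _∷_ (subT-cong e t) (subTs-cong e ts)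

  subF-cong : ∀ {Γ Δ} {r r' : Sub Γ Δ} → SubEq r r' → (φ : Formula Γ) → subF r φ ≡ subF r' φ
  subF-cong e ⊤' = refl
  subF-cong e ⊥' = refl
  subF-cong e (rel R ts) = cong (rel R) (subTs-cong e ts)
  subF-cong e (s ≐ t) = cong₂ _≐_ (subT-cong e s) (subT-cong e t)
  subF-cong e (φ ∧' ψ) = cong₂ _∧'_ (subF-cong e φ) (subF-cong e ψ)
  subF-cong e (φ ∨' ψ) = cong₂ _∨'_ (subF-cong e φ) (subF-cong e ψ)
  subF-cong e (∃' φ) = cong ∃' (subF-cong (exts-cong e) φ)

  renT-comp : ∀ {Γ Δ Θ S} (r : Ren Δ Θ) (r' : Ren Γ Δ) (t : Term Γ S) → renT r (renT r' t) ≡ renT (λ v → r (r' v)) t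
  renTs-comp : ∀ {Γ Δ Θ ss} (r : Ren Δ Θ) (r' : Ren Γ Δ) (t : Terms Γ ss) → renTs r (renTs r' t) ≡ renTs (λ v → r (r' v)) t
  renT-comp r r' (var v) = refl
  renT-comp r r' (app f ts) = cong (app f) (renTs-comp r r' ts)
  renTs-comp r r' [] = refl
  renTs-comp r r' (t ∷ ts) = cong₂ _∷_ (renT-comp r r' t) (renTs-comp r r' ts)

  renF-comp : ∀ {Γ Δ Θ} (r : Ren Δ Θ) (r' : Ren Γ Δ) (φ : Formula Γ) → renF r (renF r' φ) ≡ renF (λ v → r (r' v)) φ
  renF-comp r r' ⊤' = refl
  renF-comp r r' ⊥' = refl
  renF-comp r r' (rel R ts) = cong (rel R) (renTs-comp r r' ts)
  renF-comp r r' (s ≐ t) = cong₂ _≐_ (renT-comp r r' s) (renT-comp r r' t)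
  renF-comp r r' (φ ∧' ψ) = cong₂ _∧'_ (renF-comp r r' φ) (renF-comp r r' ψ)
  renF-comp r r' (φ ∨' ψ) = cong₂ _∨'_ (renF-comp r r' φ) (renF-comp r r' ψ)
  renF-comp r r' (∃' φ) = cong ∃' (trans (renF-comp (ext r) (ext r') φ) (renF-cong (λ { here → refl ; (there v) → refl }) φ))

  subT-ren : ∀ {Γ Δ Θ S} (σ : Sub Δ Θ) (r : Ren Γ Δ) (t : Term Γ S) → subT σ (renT r t) ≡ subT (λ v → σ (r v)) t
  subTs-ren : ∀ {Γ Δ Θ ss} (σ : Sub Δ Θ) (r : Ren Γ Δ) (t : Terms Γ ss) → subTs σ (renTs r t) ≡ subTs (λ v → σ (r v)) t
  subT-ren σ r (var v) = refl
  subT-ren σ r (app f ts) = cong (app f) (subTs-ren σ r ts)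
  subTs-ren σ r [] = refl
  subTs-ren σ r (t ∷ ts) = cong₂ _∷_ (subT-ren σ r t) (subTs-ren σ r ts)

  subF-ren : ∀ {Γ Δ Θ} (σ : Sub Δ Θ) (r : Ren Γ Δ) (φ : Formula Γ) → subF σ (renF r φ) ≡ subF (λ v → σ (r v)) φ
  subF-ren σ r ⊤' = refl
  subF-ren σ r ⊥' = refl
  subF-ren σ r (rel R ts) = cong (rel R) (subTs-ren σ r ts)
  subF-ren σ r (s ≐ t) = cong₂ _≐_ (subT-ren σ r s) (subT-ren σ r t)
  subF-ren σ r (φ ∧' ψ) = cong₂ _∧'_ (subF-ren σ r φ) (subF-ren σ r ψ)
  subF-ren σ r (φ ∨' ψ) = cong₂ _∨'_ (subF-ren σ r φ) (subF-ren σ r ψ)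
  subF-ren σ r (∃' φ) = cong ∃' (trans (subF-ren (exts σ) (ext r) φ) (subF-cong (λ { here → refl ; (there v) → refl }) φ))

  renT-sub : ∀ {Γ Δ Θ S} (r : Ren Δ Θ) (σ : Sub Γ Δ) (t : Term Γ S) → renT r (subT σ t) ≡ subT (λ v → renT r (σ v)) t
  renTs-sub : ∀ {Γ Δ Θ ss} (r : Ren Δ Θ) (σ : Sub Γ Δ) (t : Terms Γ ss) → renTs r (subTs σ t) ≡ subTs (λ v → renT r (σ v)) t
  renT-sub r σ (var v) = refl
  renT-sub r σ (app f ts) = cong (app f) (renTs-sub r σ ts)
  renTs-sub r σ [] = refl
  renTs-sub r σ (t ∷ ts) = cong₂ _∷_ (renT-sub r σ t) (renTs-sub r σ ts)

  renF-sub : ∀ {Γ Δ Θ} (r : Ren Δ Θ) (σ : Sub Γ Δ) (φ : Formula Γ) → renF r (subF σ φ) ≡ subF (λ v → renT r (σ v)) φ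
  renF-sub r σ ⊤' = refl
  renF-sub r σ ⊥' = refl
  renF-sub r σ (rel R ts) = cong (rel R) (renTs-sub r σ ts)
  renF-sub r σ (s ≐ t) = cong₂ _≐_ (renT-sub r σ s) (renT-sub r σ t)
  renF-sub r σ (φ ∧' ψ) = cong₂ _∧'_ (renF-sub r σ φ) (renF-sub r σ ψ)
  renF-sub r σ (φ ∨' ψ) = cong₂ _∨'_ (renF-sub r σ φ) (renF-sub r σ ψ)
  renF-sub r σ (∃' φ) = cong ∃' (trans (renF-sub (ext r) (exts σ) φ)
     (subF-cong (λ { here → refl ; (there v) → trans (renT-comp (ext r) there (σ v)) (sym (renT-comp there r (σ v))) }) φ))

  subT-comp : ∀ {Γ Δ Θ S} (σ : Sub Δ Θ) (τ : Sub Γ Δ) (t : Term Γ S) → subT σ (subT τ t) ≡ subT (λ v → subT σ (τ v)) t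
  subTs-comp : ∀ {Γ Δ Θ ss} (σ : Sub Δ Θ) (τ : Sub Γ Δ) (t : Terms Γ ss) → subTs σ (subTs τ t) ≡ subTs (λ v → subT σ (τ v)) t
  subT-comp σ τ (var v) = refl
  subT-comp σ τ (app f ts) = cong (app f) (subTs-comp σ τ ts)
  subTs-comp σ τ [] = refl
  subTs-comp σ τ (t ∷ ts) = cong₂ _∷_ (subT-comp σ τ t) (subTs-comp σ τ ts)

  subF-comp : ∀ {Γ Δ Θ} (σ : Sub Δ Θ) (τ : Sub Γ Δ) (φ : Formula Γ) → subF σ (subF τ φ) ≡ subF (λ v → subT σ (τ v)) φ
  subF-comp σ τ ⊤' = refl
  subF-comp σ τ ⊥' = refl
  subF-comp σ τ (rel R ts) = cong (rel R) (subTs-comp σ τ ts)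
  subF-comp σ τ (s ≐ t) = cong₂ _≐_ (subT-comp σ τ s) (subT-comp σ τ t)
  subF-comp σ τ (φ ∧' ψ) = cong₂ _∧'_ (subF-comp σ τ φ) (subF-comp σ τ ψ)
  subF-comp σ τ (φ ∨' ψ) = cong₂ _∨'_ (subF-comp σ τ φ) (subF-comp σ τ ψ)
  subF-comp σ τ (∃' φ) = cong ∃' (trans (subF-comp (exts σ) (exts τ) φ)
     (subF-cong (λ { here → refl ; (there v) → trans (subT-ren (exts σ) there (τ v)) (sym (renT-sub there σ (τ v))) }) φ))

  renT≡subT : ∀ {Γ Δ S} (r : Ren Γ Δ) (t : Term Γ S) → renT r t ≡ subT (λ v → var (r v)) t
  renTs≡subTs : ∀ {Γ Δ ss} (r : Ren Γ Δ) (t : Terms Γ ss) → renTs r t ≡ subTs (λ v → var (r v)) t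
  renT≡subT r (var v) = refl
  renT≡subT r (app f ts) = cong (app f) (renTs≡subTs r ts)
  renTs≡subTs r [] = refl
  renTs≡subTs r (t ∷ ts) = cong₂ _∷_ (renT≡subT r t) (renTs≡subTs r ts)

  renF≡subF : ∀ {Γ Δ} (r : Ren Γ Δ) (φ : Formula Γ) → renF r φ ≡ subF (λ v → var (r v)) φ
  renF≡subF r ⊤' = refl
  renF≡subF r ⊥' = refl
  renF≡subF r (rel R ts) = cong (rel R) (renTs≡subTs r ts)
  renF≡subF r (s ≐ t) = cong₂ _≐_ (renT≡subT r s) (renT≡subT r t)
  renF≡subF r (φ ∧' ψ) = cong₂ _∧'_ (renF≡subF r φ) (renF≡subF r ψ)
  renF≡subF r (φ ∨' ψ) = cong₂ _∨'_ (renF≡subF r φ) (renF≡subF r ψ)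
  renF≡subF r (∃' φ) = cong ∃' (trans (renF≡subF (ext r) φ) (subF-cong (λ { here → refl ; (there v) → refl }) φ))

  renT-id : ∀ {Γ S} (t : Term Γ S) → renT (λ v → v) t ≡ t
  renTs-id : ∀ {Γ ss} (t : Terms Γ ss) → renTs (λ v → v) t ≡ t
  renT-id (var v) = refl
  renT-id (app f ts) = cong (app f) (renTs-id ts)
  renTs-id [] = refl
  renTs-id (t ∷ ts) = cong₂ _∷_ (renT-id t) (renTs-id ts)

  renF-id : ∀ {Γ} (φ : Formula Γ) → renF (λ v → v) φ ≡ φ
  renF-id ⊤' = refl
  renF-id ⊥' = refl
  renF-id (rel R ts) = cong (rel R) (renTs-id ts)
  renF-id (s ≐ t) = cong₂ _≐_ (renT-id s) (renT-id t)
  renF-id (φ ∧' ψ) = cong₂ _∧'_ (renF-id φ) (renF-id ψ)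
  renF-id (φ ∨' ψ) = cong₂ _∨'_ (renF-id φ) (renF-id ψ)
  renF-id (∃' φ) = cong ∃' (trans (renF-cong (λ { here → refl ; (there v) → refl }) φ) (renF-id φ))

  subF-id : ∀ {Γ} (φ : Formula Γ) → subF var φ ≡ φ
  subF-id φ = trans (sym (renF≡subF (λ v → v) φ)) (renF-id φ)

  sub0-wkT : ∀ {Γ S S'} (t : Term Γ S) (u : Term Γ S') → subT (sub0 t) (renT there u) ≡ u
  sub0-wkT t u = trans (subT-ren (sub0 t) there u) (trans (sym (renT≡subT (λ v → v) u)) (renT-id u))

  sub0-wk : ∀ {Γ S} (t : Term Γ S) (φ : Formula Γ) → subF (sub0 t) (wk φ) ≡ φ
  sub0-wk t φ = trans (subF-ren (sub0 t) there φ) (subF-id φ)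

  ⋀-ren : ∀ {Γ Δ} {A : Set} (r : Ren Γ Δ) (ss : List A) (f : ∀ {S} → ss ∋ S → Formula Γ) →
          renF r (⋀ ss f) ≡ ⋀ ss (λ v → renF r (f v))
  ⋀-ren r [] f = refl
  ⋀-ren r (S ∷ ss) f = cong₂ _∧'_ refl (⋀-ren r ss (λ v → f (there v)))

  ⋀-sub : ∀ {Γ Δ} {A : Set} (r : Sub Γ Δ) (ss : List A) (f : ∀ {S} → ss ∋ S → Formula Γ) →
          subF r (⋀ ss f) ≡ ⋀ ss (λ v → subF r (f v))
  ⋀-sub r [] f = refl
  ⋀-sub r (S ∷ ss) f = cong₂ _∧'_ refl (⋀-sub r ss (λ v → f (there v)))

  ⋀-cong : ∀ {Γ} {A : Set} (ss : List A) {f g : ∀ {S} → ss ∋ S → Formula Γ} → (∀ {S} (v : ss ∋ S) → f v ≡ g v) → ⋀ ss f ≡ ⋀ ss g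
  ⋀-cong [] e = refl
  ⋀-cong (S ∷ ss) e = cong₂ _∧'_ (e here) (⋀-cong ss (λ v → e (there v)))

  ⋁ₗ-sub : ∀ {Γ Δ} {A : Set} (r : Sub Γ Δ) (ss : List A) (f : ∀ {S} → ss ∋ S → Formula Γ) →
          subF r (⋁ₗ ss f) ≡ ⋁ₗ ss (λ v → subF r (f v))
  ⋁ₗ-sub r [] f = refl
  ⋁ₗ-sub r (S ∷ ss) f = cong₂ _∨'_ refl (⋁ₗ-sub r ss (λ v → f (there v)))

  ⋁-cong : ∀ {Ξ} (n : ℕ) {f g : Fin n → Formula Ξ} → (∀ k → f k ≡ g k) → ⋁ n f ≡ ⋁ n g
  ⋁-cong zero e = refl
  ⋁-cong (suc n) e = cong₂ _∨'_ (e zero) (⋁-cong n (λ k → e (suc k)))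

  liftRen : ∀ {Γ Δ} (ys : Ctx) → Ren Γ Δ → Ren (ys ++ Γ) (ys ++ Δ)
  liftRen [] r = r
  liftRen (S ∷ ys) r = ext (liftRen ys r)

  sub2 : ∀ {Ξ X} → Term Ξ X → Term Ξ X → Sub (X ∷ X ∷ []) Ξ
  sub2 a b here = a
  sub2 a b (there here) = b

  sub3 : ∀ {Ξ X Y Z} → Term Ξ X → Term Ξ Y → Term Ξ Z → Sub (X ∷ Y ∷ Z ∷ []) Ξ
  sub3 a b c here = a
  sub3 a b c (there here) = b
  sub3 a b c (there (there here)) = c

  sub1 : ∀ {Ξ X} → Term Ξ X → Sub (X ∷ []) Ξ
  sub1 a here = a

  subF-inr-cancel : ∀ {Ξ} (ys : Ctx) (σ : Sub (ys ++ Ξ) Ξ) → (∀ {X} (u : Ξ ∋ X) → σ (inr ys u) ≡ var u) →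
               (φ : Formula Ξ) → subF σ (renF (inr ys) φ) ≡ φ
  subF-inr-cancel ys σ e φ = trans (subF-ren σ (inr ys) φ) (trans (subF-cong e φ) (subF-id φ))

  subT-inr-cancel : ∀ {Ξ X} (ys : Ctx) (σ : Sub (ys ++ Ξ) Ξ) → (∀ {X} (u : Ξ ∋ X) → σ (inr ys u) ≡ var u) →
               (t : Term Ξ X) → subT σ (renT (inr ys) t) ≡ t
  subT-inr-cancel ys σ e t = trans (subT-ren σ (inr ys) t) (trans (subT-cong e t) (trans (sym (renT≡subT (λ v → v) t)) (renT-id t)))

  headSub : ∀ {Ξ Ξ' X} → Term Ξ' X → Ren Ξ Ξ' → Sub (X ∷ Ξ) Ξ'
  headSub a w here = a
  headSub a w (there v) = var (w v)

  headSub-wkT : ∀ {Ξ Ξ' X Y} (a : Term Ξ' X) (w : Ren Ξ Ξ') (u : Term Ξ Y) → subT (headSub a w) (renT there u) ≡ renT w u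
  headSub-wkT a w u = trans (subT-ren (headSub a w) there u) (sym (renT≡subT w u))

  headSub≡sub0 : ∀ {Ξ Ξ' X} (a : Term Ξ' X) (w : Ren Ξ Ξ') (Q : Formula (X ∷ Ξ)) → subF (headSub a w) Q ≡ subF (sub0 a) (renF (ext w) Q)
  headSub≡sub0 a w Q = sym (trans (subF-ren (sub0 a) (ext w) Q) (subF-cong (λ { here → refl ; (there v) → refl }) Q))

  renF-headSub : ∀ {Ξ Ξ' Ξ'' X} (r : Ren Ξ' Ξ'') (a : Term Ξ' X) (w : Ren Ξ Ξ') (Q : Formula (X ∷ Ξ)) →
              renF r (subF (headSub a w) Q) ≡ subF (headSub (renT r a) (λ v → r (w v))) Q
  renF-headSub r a w Q = trans (renF-sub r (headSub a w) Q) (subF-cong (λ { here → refl ; (there v) → refl }) Q)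

  replaceHead : ∀ {Ξ X Y} → Term (Y ∷ Ξ) X → Sub (X ∷ Ξ) (Y ∷ Ξ)
  replaceHead u here = u
  replaceHead u (there v) = var (there v)

  headSub-replaceHead : ∀ {Ξ Ξ' X Y} (b : Term Ξ' Y) (w : Ren Ξ Ξ') (u : Term (Y ∷ Ξ) X) (P : Formula (X ∷ Ξ)) →
                subF (headSub b w) (subF (replaceHead u) P) ≡ subF (headSub (subT (headSub b w) u) w) P
  headSub-replaceHead b w u P = trans (subF-comp (headSub b w) (replaceHead u) P) (subF-cong (λ { here → refl ; (there v) → refl }) P)

  subTs-tab : ∀ {Γ Δ} (ss : Ctx) (σ : Sub Γ Δ) (f : ∀ {S} → ss ∋ S → Term Γ S) → subTs σ (tab ss f) ≡ tab ss (λ u → subT σ (f u))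
  subTs-tab [] σ f = refl
  subTs-tab (S ∷ ss) σ f = cong₂ _∷_ refl (subTs-tab ss σ (λ u → f (there u)))

  renTs-tab : ∀ {Γ Δ} (ss : Ctx) (r : Ren Γ Δ) (f : ∀ {S} → ss ∋ S → Term Γ S) → renTs r (tab ss f) ≡ tab ss (λ u → renT r (f u))
  renTs-tab [] r f = refl
  renTs-tab (S ∷ ss) r f = cong₂ _∷_ refl (renTs-tab ss r (λ u → f (there u)))

  tab-cong : ∀ {Γ} (ss : Ctx) {f g : ∀ {S} → ss ∋ S → Term Γ S} → (∀ {S} (u : ss ∋ S) → f u ≡ g u) → tab ss f ≡ tab ss g
  tab-cong [] e = refl
  tab-cong (S ∷ ss) e = cong₂ _∷_ (e here) (tab-cong ss (λ u → e (there u)))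

module DerivedRules (sig : Signature) (T : Syntax.Theory sig) where
  open Signature sig
  open Syntax sig
  open SyntaxProperties sig

  infixl 5 _⟫_
  _⟫_ : ∀ {Γ φ ψ χ} → Pf T Γ φ ψ → Pf T Γ ψ χ → Pf T Γ φ χ
  _⟫_ = cut

  ≡⇒Pf : ∀ {Γ} {φ ψ : Formula Γ} → φ ≡ ψ → Pf T Γ φ ψ
  ≡⇒Pf refl = idt

  castL : ∀ {Γ} {φ φ' ψ : Formula Γ} → φ ≡ φ' → Pf T Γ φ ψ → Pf T Γ φ' ψ
  castL refl p = p

  castR : ∀ {Γ} {φ ψ ψ' : Formula Γ} → ψ ≡ ψ' → Pf T Γ φ ψ → Pf T Γ φ ψ'
  castR refl p = p

  renPf : ∀ {Γ Δ} {φ ψ : Formula Γ} (r : Ren Γ Δ) → Pf T Γ φ ψ → Pf T Δ (renF r φ) (renF r ψ)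
  renPf r p = castL (sym (renF≡subF r _)) (castR (sym (renF≡subF r _)) (subst (λ v → var (r v)) p))

  ∧-map : ∀ {Γ} {a b a' b' : Formula Γ} → Pf T Γ a a' → Pf T Γ b b' → Pf T Γ (a ∧' b) (a' ∧' b')
  ∧-map p q = ∧-intro (∧-el₁ ⟫ p) (∧-el₂ ⟫ q)

  ∃-elimH : ∀ {Γ S} {H : Formula Γ} {φ : Formula (S ∷ Γ)} {C} →
            Pf T (S ∷ Γ) (wk H ∧' φ) (wk C) → Pf T Γ (H ∧' ∃' φ) C
  ∃-elimH p = frob ⟫ ∃-elim p

  ∨-elimH : ∀ {Γ} {H A B C : Formula Γ} → Pf T Γ (H ∧' A) C → Pf T Γ (H ∧' B) C → Pf T Γ (H ∧' (A ∨' B)) C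
  ∨-elimH p q = dist ⟫ ∨-elim p q

  ∃-intro-here : ∀ {Γ S} {φ : Formula (S ∷ Γ)} → Pf T (S ∷ Γ) φ (wk (∃' φ))
  ∃-intro-here = ∃-unel idt

  ∃-intro : ∀ {Γ S} {φ : Formula (S ∷ Γ)} (t : Term Γ S) → Pf T Γ (subF (sub0 t) φ) (∃' φ)
  ∃-intro {φ = φ} t = castR (sub0-wk t (∃' φ)) (subst (sub0 t) (∃-intro-here {φ = φ}))

  eq-reflT : ∀ {Γ S} {H : Formula Γ} (t : Term Γ S) → Pf T Γ H (t ≐ t)
  eq-reflT t = top ⟫ subst (sub0 t) (eq-refl here)

  eq-rewrite : ∀ {Γ S} {H : Formula Γ} {s t : Term Γ S} (φ : Formula (S ∷ Γ)) →
         Pf T Γ H (s ≐ t) → Pf T Γ H (subF (sub0 s) φ) → Pf T Γ H (subF (sub0 t) φ)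
  eq-rewrite φ e p = ∧-intro e p ⟫ eq-subst _ _ φ

  eq-sym : ∀ {Γ S} {H : Formula Γ} {s t : Term Γ S} → Pf T Γ H (s ≐ t) → Pf T Γ H (t ≐ s)
  eq-sym {s = s} {t} e =
    castR (cong₂ _≐_ refl (sub0-wkT t s))
      (eq-rewrite (var here ≐ renT there s) e (castR (cong₂ _≐_ refl (sym (sub0-wkT s s))) (eq-reflT s)))

  eq-trans : ∀ {Γ S} {H : Formula Γ} {s t u : Term Γ S} → Pf T Γ H (s ≐ t) → Pf T Γ H (t ≐ u) → Pf T Γ H (s ≐ u)
  eq-trans {s = s} {t} {u} e₁ e₂ =
    castR (cong₂ _≐_ (sub0-wkT u s) refl)
      (eq-rewrite (renT there s ≐ var here) e₂ (castR (cong₂ _≐_ (sym (sub0-wkT t s)) refl) e₁))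

  eq-rewriteʰ : ∀ {Γ S} {H : Formula Γ} {s t : Term Γ S} (φ : Formula (S ∷ Γ)) →
          Pf T Γ H (s ≐ t) → Pf T Γ (H ∧' subF (sub0 s) φ) (subF (sub0 t) φ)
  eq-rewriteʰ φ e = eq-rewrite φ (∧-el₁ ⟫ e) ∧-el₂

  ⋀-intro : ∀ {Γ} {A : Set} {H : Formula Γ} (ss : List A) {f : ∀ {S} → ss ∋ S → Formula Γ} →
            (∀ {S} (v : ss ∋ S) → Pf T Γ H (f v)) → Pf T Γ H (⋀ ss f)
  ⋀-intro [] p = top
  ⋀-intro (S ∷ ss) p = ∧-intro (p here) (⋀-intro ss (λ v → p (there v)))

  ⋀-elim : ∀ {Γ} {A : Set} (ss : List A) {f : ∀ {S} → ss ∋ S → Formula Γ} {S} (v : ss ∋ S) → Pf T Γ (⋀ ss f) (f v)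
  ⋀-elim (S ∷ ss) here = ∧-el₁
  ⋀-elim (S ∷ ss) (there v) = ∧-el₂ ⟫ ⋀-elim ss v

  ⋁-intro : ∀ {Γ} (n : ℕ) {f : Fin n → Formula Γ} (k : Fin n) → Pf T Γ (f k) (⋁ n f)
  ⋁-intro (suc n) zero = ∨-in₁
  ⋁-intro (suc n) (suc k) = ⋁-intro n k ⟫ ∨-in₂

  ∃*-intro : ∀ {Γ} (ys : Ctx) {B : Formula (ys ++ Γ)} → Pf T (ys ++ Γ) B (renF (inr ys) (∃* ys B))
  ∃*-intro [] {B} = ≡⇒Pf (sym (renF-id B))
  ∃*-intro (S ∷ ys) {B} = ∃-intro-here ⟫ castR (renF-comp there (inr ys) (∃* ys (∃' B))) (renPf there (∃*-intro ys {∃' B}))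

  ∃*-elimH : ∀ {Γ} (ys : Ctx) {H C : Formula Γ} {B : Formula (ys ++ Γ)} →
             Pf T (ys ++ Γ) (renF (inr ys) H ∧' B) (renF (inr ys) C) → Pf T Γ (H ∧' ∃* ys B) C
  ∃*-elimH [] {H} {C} p = castL (cong₂ _∧'_ (renF-id H) refl) (castR (renF-id C) p)
  ∃*-elimH (S ∷ ys) {H} {C} {B} p =
    ∃*-elimH ys (∃-elimH (castL (cong₂ _∧'_ (sym (renF-comp there (inr ys) H)) refl)
                           (castR (sym (renF-comp there (inr ys) C)) p)))

  axiomInst : ∀ {Γ Ξ φ ψ} → Ax T Γ φ ψ → (σ : Sub Γ Ξ) → Pf T Ξ (subF σ φ) (subF σ ψ)
  axiomInst a σ = subst σ (axiom a)

  eq-cong : ∀ {Ξ X Y} {H : Formula Ξ} {s t : Term Ξ X} (u : Term (X ∷ Ξ) Y) →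
             Pf T Ξ H (s ≐ t) → Pf T Ξ H (subT (sub0 s) u ≐ subT (sub0 t) u)
  eq-cong {s = s} {t} u e =
    castR (cong₂ _≐_ (sub0-wkT t (subT (sub0 s) u)) refl)
      (eq-rewrite (renT there (subT (sub0 s) u) ≐ u) e
        (castR (cong₂ _≐_ (sym (sub0-wkT s (subT (sub0 s) u))) refl) (eq-reflT _)))

  ⋁-map : ∀ {Ξ} (n : ℕ) {f g : Fin n → Formula Ξ} → (∀ k → Pf T Ξ (f k) (g k)) → Pf T Ξ (⋁ n f) (⋁ n g)
  ⋁-map zero p = bot
  ⋁-map (suc n) p = ∨-elim (p zero ⟫ ∨-in₁) (⋁-map n (λ k → p (suc k)) ⟫ ∨-in₂)

  ⋁-elimH : ∀ {Ξ} {H C : Formula Ξ} (n : ℕ) {f : Fin n → Formula Ξ} → (∀ k → Pf T Ξ (H ∧' f k) C) → Pf T Ξ (H ∧' ⋁ n f) C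
  ⋁-elimH zero p = ∧-el₂ ⟫ bot
  ⋁-elimH (suc n) p = ∨-elimH (p zero) (⋁-elimH n (λ k → p (suc k)))

  ⋁ₗ→⋁ : ∀ {Ξ} {B : Set} (ss : List B) (f : ∀ {S} → ss ∋ S → Formula Ξ) →
         Pf T Ξ (⋁ₗ ss f) (⋁ (length ss) (λ k → f (proj₂ (nthPos ss k))))
  ⋁ₗ→⋁ [] f = idt
  ⋁ₗ→⋁ (S ∷ ss) f = ∨-elim ∨-in₁ (⋁ₗ→⋁ ss (λ v → f (there v)) ⟫ ∨-in₂)

  Equiv : ∀ {Ξ} → Formula Ξ → Formula Ξ → Formula Ξ → Set
  Equiv H A B = Pf T _ (H ∧' A) B × Pf T _ (H ∧' B) A

  castEquiv : ∀ {Ξ} {H A A' B B' : Formula Ξ} → A ≡ A' → B ≡ B' → Equiv H A B → Equiv H A' B'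
  castEquiv refl refl p = p

  hyp-renF-id : ∀ {Ξ} (H : Formula Ξ) → Pf T Ξ H (renF idRen H)
  hyp-renF-id H = castR (sym (renF-id H)) idt

  eq-rewrite-headSub : ∀ {Ξ Ξ' X} {H : Formula Ξ'} {a b : Term Ξ' X} (w : Ren Ξ Ξ') (Q : Formula (X ∷ Ξ)) →
         Pf T Ξ' H (a ≐ b) → Pf T Ξ' (H ∧' subF (headSub a w) Q) (subF (headSub b w) Q)
  eq-rewrite-headSub {a = a} {b} w Q e = castL (cong₂ _∧'_ refl (sym (headSub≡sub0 a w Q))) (castR (sym (headSub≡sub0 b w Q)) (eq-rewriteʰ (renF (ext w) Q) e))

  eq-rewrite-equiv : ∀ {Ξ Ξ' X} {H : Formula Ξ'} {a b : Term Ξ' X} (w : Ren Ξ Ξ') (Q : Formula (X ∷ Ξ)) →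
         Pf T Ξ' H (a ≐ b) → Equiv H (subF (headSub a w) Q) (subF (headSub b w) Q)
  eq-rewrite-equiv w Q e = eq-rewrite-headSub w Q e , eq-rewrite-headSub w Q (eq-sym e)

  equiv-trans : ∀ {Ξ} {H A B C : Formula Ξ} → Equiv H A B → Equiv H B C → Equiv H A C
  equiv-trans (p , p') (q , q') = ∧-intro ∧-el₁ p ⟫ q , ∧-intro ∧-el₁ q' ⟫ p'

  hyp-renF-comp : ∀ {Ξ Ξ' Ξ''} {H : Formula Ξ} {H' : Formula Ξ'} (w : Ren Ξ Ξ') (w' : Ren Ξ' Ξ'') {H'' : Formula Ξ''} →
          Pf T Ξ' H' (renF w H) → Pf T Ξ'' H'' (renF w' H') → Pf T Ξ'' H'' (renF (λ v → w' (w v)) H)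
  hyp-renF-comp {H = H} w w' hyp hyp' = hyp' ⟫ castR (renF-comp w' w H) (renPf w' hyp)

  ∃-⊤∧ : ∀ {Ξ S} {φ : Formula (S ∷ Ξ)} → Pf T Ξ (∃' φ) (∃' (⊤' ∧' φ))
  ∃-⊤∧ = ∃-elim (∧-intro top idt ⟫ ∃-intro-here)

  ∃*-intro-ren : ∀ {Ξ Ξ'} (ys : Ctx) (B : Formula (ys ++ Ξ)) (c : Ren ys Ξ') (w : Ren Ξ Ξ') →
                Pf T Ξ' (renF (copair ys c w) B) (renF w (∃* ys B))
  ∃*-intro-ren ys B c w = castR (trans (renF-comp _ (inr ys) _) (renF-cong (copair-inr ys c w) _)) (renPf (copair ys c w) (∃*-intro ys {B}))

module MoritaTranslation {Σ₁ : Signature} {T₁ : Syntax.Theory Σ₁} (M : MoritaData T₁) where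
  open MoritaData M
  open Ext M
  open S₂
  open SyntaxProperties Σ₂
  open DerivedRules Σ₂ T₂
  open Signature Σ₁ renaming (Sort to Sort₁; Fun to Fun₁; Rel to Rel₁; fdom to fdom₁; fcod to fcod₁; rdom to rdom₁)

  infix 4 _⇒_
  _⇒_ : S₁.Ctx → Ctx → Set
  Δ ⇒ Ξ = ∀ {S} → Δ ∋ S → Ξ ∋ old S

  trT⇒ : ∀ {Δ Ξ S} → Δ ⇒ Ξ → S₁.Term Δ S → Term Ξ (old S)
  trTs⇒ : ∀ {Δ Ξ ss} → Δ ⇒ Ξ → S₁.Terms Δ ss → Terms Ξ (map old ss)
  trT⇒ d (S₁.var v) = var (d v)
  trT⇒ d (S₁.app f ts) = app (oldF f) (trTs⇒ d ts)
  trTs⇒ d S₁.[] = []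
  trTs⇒ d (t S₁.∷ ts) = trT⇒ d t ∷ trTs⇒ d ts

  ext⇒ : ∀ {Δ Ξ S} → Δ ⇒ Ξ → (S ∷ Δ) ⇒ (old S ∷ Ξ)
  ext⇒ d here = here
  ext⇒ d (there v) = there (d v)

  tr⇒ : ∀ {Δ Ξ} → Δ ⇒ Ξ → S₁.Formula Δ → Formula Ξ
  tr⇒ d S₁.⊤' = ⊤'
  tr⇒ d S₁.⊥' = ⊥'
  tr⇒ d (S₁.rel R ts) = rel (oldR R) (trTs⇒ d ts)
  tr⇒ d (s S₁.≐ t) = trT⇒ d s ≐ trT⇒ d t
  tr⇒ d (φ S₁.∧' ψ) = tr⇒ d φ ∧' tr⇒ d ψ
  tr⇒ d (φ S₁.∨' ψ) = tr⇒ d φ ∨' tr⇒ d ψ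
  tr⇒ d (S₁.∃' φ) = ∃' (tr⇒ (ext⇒ d) φ)

  DEq : ∀ {Δ Ξ} → Δ ⇒ Ξ → Δ ⇒ Ξ → Set
  DEq {Δ} d d' = ∀ {S} (v : Δ ∋ S) → d v ≡ d' v

  ext⇒-cong : ∀ {Δ Ξ S} {d d' : Δ ⇒ Ξ} → DEq d d' → DEq (ext⇒ {S = S} d) (ext⇒ d')
  ext⇒-cong e here = refl
  ext⇒-cong e (there v) = cong there (e v)

  trT⇒-cong : ∀ {Δ Ξ S} {d d' : Δ ⇒ Ξ} → DEq d d' → (t : S₁.Term Δ S) → trT⇒ d t ≡ trT⇒ d' t
  trTs⇒-cong : ∀ {Δ Ξ ss} {d d' : Δ ⇒ Ξ} → DEq d d' → (t : S₁.Terms Δ ss) → trTs⇒ d t ≡ trTs⇒ d' t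
  trT⇒-cong e (S₁.var v) = cong var (e v)
  trT⇒-cong e (S₁.app f ts) = cong (app (oldF f)) (trTs⇒-cong e ts)
  trTs⇒-cong e S₁.[] = refl
  trTs⇒-cong e (t S₁.∷ ts) = cong₂ _∷_ (trT⇒-cong e t) (trTs⇒-cong e ts)

  tr⇒-cong : ∀ {Δ Ξ} {d d' : Δ ⇒ Ξ} → DEq d d' → (φ : S₁.Formula Δ) → tr⇒ d φ ≡ tr⇒ d' φ
  tr⇒-cong e S₁.⊤' = refl
  tr⇒-cong e S₁.⊥' = refl
  tr⇒-cong e (S₁.rel R ts) = cong (rel (oldR R)) (trTs⇒-cong e ts)
  tr⇒-cong e (s S₁.≐ t) = cong₂ _≐_ (trT⇒-cong e s) (trT⇒-cong e t)
  tr⇒-cong e (φ S₁.∧' ψ) = cong₂ _∧'_ (tr⇒-cong e φ) (tr⇒-cong e ψ)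
  tr⇒-cong e (φ S₁.∨' ψ) = cong₂ _∨'_ (tr⇒-cong e φ) (tr⇒-cong e ψ)
  tr⇒-cong e (S₁.∃' φ) = cong ∃' (tr⇒-cong (ext⇒-cong e) φ)

  renT-trT⇒ : ∀ {Δ Ξ Ξ' S} (r : Ren Ξ Ξ') (d : Δ ⇒ Ξ) (t : S₁.Term Δ S) → renT r (trT⇒ d t) ≡ trT⇒ (λ v → r (d v)) t
  renTs-trTs⇒ : ∀ {Δ Ξ Ξ' ss} (r : Ren Ξ Ξ') (d : Δ ⇒ Ξ) (t : S₁.Terms Δ ss) → renTs r (trTs⇒ d t) ≡ trTs⇒ (λ v → r (d v)) t
  renT-trT⇒ r d (S₁.var v) = refl
  renT-trT⇒ r d (S₁.app f ts) = cong (app (oldF f)) (renTs-trTs⇒ r d ts)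
  renTs-trTs⇒ r d S₁.[] = refl
  renTs-trTs⇒ r d (t S₁.∷ ts) = cong₂ _∷_ (renT-trT⇒ r d t) (renTs-trTs⇒ r d ts)

  renF-tr⇒ : ∀ {Δ Ξ Ξ'} (r : Ren Ξ Ξ') (d : Δ ⇒ Ξ) (φ : S₁.Formula Δ) → renF r (tr⇒ d φ) ≡ tr⇒ (λ v → r (d v)) φ
  renF-tr⇒ r d S₁.⊤' = refl
  renF-tr⇒ r d S₁.⊥' = refl
  renF-tr⇒ r d (S₁.rel R ts) = cong (rel (oldR R)) (renTs-trTs⇒ r d ts)
  renF-tr⇒ r d (s S₁.≐ t) = cong₂ _≐_ (renT-trT⇒ r d s) (renT-trT⇒ r d t)
  renF-tr⇒ r d (φ S₁.∧' ψ) = cong₂ _∧'_ (renF-tr⇒ r d φ) (renF-tr⇒ r d ψ)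
  renF-tr⇒ r d (φ S₁.∨' ψ) = cong₂ _∨'_ (renF-tr⇒ r d φ) (renF-tr⇒ r d ψ)
  renF-tr⇒ r d (S₁.∃' φ) = cong ∃' (trans (renF-tr⇒ (ext r) (ext⇒ d) φ) (tr⇒-cong (λ { here → refl ; (there v) → refl }) φ))

  trT⇒-renT : ∀ {Δ Δ' Ξ S} (d : Δ' ⇒ Ξ) (r : Ren Δ Δ') (t : S₁.Term Δ S) → trT⇒ d (S₁.renT r t) ≡ trT⇒ (λ v → d (r v)) t
  trTs⇒-renTs : ∀ {Δ Δ' Ξ ss} (d : Δ' ⇒ Ξ) (r : Ren Δ Δ') (t : S₁.Terms Δ ss) → trTs⇒ d (S₁.renTs r t) ≡ trTs⇒ (λ v → d (r v)) t
  trT⇒-renT d r (S₁.var v) = refl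
  trT⇒-renT d r (S₁.app f ts) = cong (app (oldF f)) (trTs⇒-renTs d r ts)
  trTs⇒-renTs d r S₁.[] = refl
  trTs⇒-renTs d r (t S₁.∷ ts) = cong₂ _∷_ (trT⇒-renT d r t) (trTs⇒-renTs d r ts)

  tr⇒-renF : ∀ {Δ Δ' Ξ} (d : Δ' ⇒ Ξ) (r : Ren Δ Δ') (φ : S₁.Formula Δ) → tr⇒ d (S₁.renF r φ) ≡ tr⇒ (λ v → d (r v)) φ
  tr⇒-renF d r S₁.⊤' = refl
  tr⇒-renF d r S₁.⊥' = refl
  tr⇒-renF d r (S₁.rel R ts) = cong (rel (oldR R)) (trTs⇒-renTs d r ts)
  tr⇒-renF d r (s S₁.≐ t) = cong₂ _≐_ (trT⇒-renT d r s) (trT⇒-renT d r t)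
  tr⇒-renF d r (φ S₁.∧' ψ) = cong₂ _∧'_ (tr⇒-renF d r φ) (tr⇒-renF d r ψ)
  tr⇒-renF d r (φ S₁.∨' ψ) = cong₂ _∨'_ (tr⇒-renF d r φ) (tr⇒-renF d r ψ)
  tr⇒-renF d r (S₁.∃' φ) = cong ∃' (trans (tr⇒-renF (ext⇒ d) (S₁.ext r) φ) (tr⇒-cong (λ { here → refl ; (there v) → refl }) φ))

  trT≡trT⇒ : ∀ {Δ S} (t : S₁.Term Δ S) → trT t ≡ trT⇒ (mapVar old) t
  trTs≡trTs⇒ : ∀ {Δ ss} (t : S₁.Terms Δ ss) → trTs t ≡ trTs⇒ (mapVar old) t
  trT≡trT⇒ (S₁.var v) = refl
  trT≡trT⇒ (S₁.app f ts) = cong (app (oldF f)) (trTs≡trTs⇒ ts)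
  trTs≡trTs⇒ S₁.[] = refl
  trTs≡trTs⇒ (t S₁.∷ ts) = cong₂ _∷_ (trT≡trT⇒ t) (trTs≡trTs⇒ ts)

  tr≡tr⇒ : ∀ {Δ} (φ : S₁.Formula Δ) → tr φ ≡ tr⇒ (mapVar old) φ
  tr≡tr⇒ S₁.⊤' = refl
  tr≡tr⇒ S₁.⊥' = refl
  tr≡tr⇒ (S₁.rel R ts) = cong (rel (oldR R)) (trTs≡trTs⇒ ts)
  tr≡tr⇒ (s S₁.≐ t) = cong₂ _≐_ (trT≡trT⇒ s) (trT≡trT⇒ t)
  tr≡tr⇒ (φ S₁.∧' ψ) = cong₂ _∧'_ (tr≡tr⇒ φ) (tr≡tr⇒ ψ)
  tr≡tr⇒ (φ S₁.∨' ψ) = cong₂ _∨'_ (tr≡tr⇒ φ) (tr≡tr⇒ ψ)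
  tr≡tr⇒ (S₁.∃' φ) = cong ∃' (trans (tr≡tr⇒ φ) (tr⇒-cong (λ { here → refl ; (there v) → refl }) φ))

  unmap : ∀ {L Ξ} → L ⇒ Ξ → Ren (map old L) Ξ
  unmap {S ∷ L} d here = d here
  unmap {S ∷ L} d (there u) = unmap (λ v → d (there v)) u

  unmap-mapVar : ∀ {L Ξ} (d : L ⇒ Ξ) {S} (v : L ∋ S) → unmap d (mapVar old v) ≡ d v
  unmap-mapVar d here = refl
  unmap-mapVar d (there v) = unmap-mapVar (λ w → d (there w)) v

  tr⇒≡renF-tr : ∀ {Δ Ξ} (d : Δ ⇒ Ξ) (φ : S₁.Formula Δ) → tr⇒ d φ ≡ renF (unmap d) (tr φ)
  tr⇒≡renF-tr d φ = sym (trans (cong (renF (unmap d)) (tr≡tr⇒ φ)) (trans (renF-tr⇒ (unmap d) (mapVar old) φ) (tr⇒-cong (unmap-mapVar d) φ)))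

  lift⇒ : ∀ {Δ Ξ} (L : S₁.Ctx) → Δ ⇒ Ξ → (L ++ Δ) ⇒ (map old L ++ Ξ)
  lift⇒ [] d = d
  lift⇒ (S ∷ L) d = ext⇒ (lift⇒ L d)

  lift⇒-inl : ∀ {Δ Ξ} (L : S₁.Ctx) (d : Δ ⇒ Ξ) {S} (e : L ∋ S) → lift⇒ L d (inl e) ≡ inl (mapVar old e)
  lift⇒-inl (S ∷ L) d here = refl
  lift⇒-inl (S ∷ L) d (there e) = cong there (lift⇒-inl L d e)

  lift⇒-inr : ∀ {Δ Ξ} (L : S₁.Ctx) (d : Δ ⇒ Ξ) {S} (z : Δ ∋ S) → lift⇒ L d (inr L z) ≡ inr (map old L) (d z)
  lift⇒-inr [] d z = refl
  lift⇒-inr (S ∷ L) d z = cong there (lift⇒-inr L d z)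

  tr⇒-∃* : ∀ {Δ Ξ} (d : Δ ⇒ Ξ) (L : S₁.Ctx) (B : S₁.Formula (L ++ Δ)) → tr⇒ d (S₁.∃* L B) ≡ ∃* (map old L) (tr⇒ (lift⇒ L d) B)
  tr⇒-∃* d [] B = refl
  tr⇒-∃* d (S ∷ L) B = tr⇒-∃* d L (S₁.∃' B)

  tr⇒-⋁ : ∀ {Δ Ξ} (d : Δ ⇒ Ξ) (n : ℕ) (f : Fin n → S₁.Formula Δ) → tr⇒ d (S₁.⋁ n f) ≡ ⋁ n (λ k → tr⇒ d (f k))
  tr⇒-⋁ d zero f = refl
  tr⇒-⋁ d (suc n) f = cong₂ _∨'_ refl (tr⇒-⋁ d n (λ k → f (suc k)))

  tr⇒-⋀ : ∀ {Δ Ξ} {B : Set} (d : Δ ⇒ Ξ) (ss : List B) (f : ∀ {S} → ss ∋ S → S₁.Formula Δ) → tr⇒ d (S₁.⋀ ss f) ≡ ⋀ ss (λ v → tr⇒ d (f v))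
  tr⇒-⋀ d [] f = refl
  tr⇒-⋀ d (S ∷ ss) f = cong₂ _∧'_ refl (tr⇒-⋀ d ss (λ v → f (there v)))

  copair⇒ : ∀ {Δ Ξ} (L : S₁.Ctx) → L ⇒ Ξ → Δ ⇒ Ξ → (L ++ Δ) ⇒ Ξ
  copair⇒ [] d₁ d₂ = d₂
  copair⇒ (S ∷ L) d₁ d₂ here = d₁ here
  copair⇒ (S ∷ L) d₁ d₂ (there v) = copair⇒ L (λ w → d₁ (there w)) d₂ v

  copair⇒-inl : ∀ {Δ Ξ} (L : S₁.Ctx) (d₁ : L ⇒ Ξ) (d₂ : Δ ⇒ Ξ) {S} (e : L ∋ S) → copair⇒ L d₁ d₂ (inl e) ≡ d₁ e
  copair⇒-inl (S ∷ L) d₁ d₂ here = refl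
  copair⇒-inl (S ∷ L) d₁ d₂ (there e) = copair⇒-inl L (λ w → d₁ (there w)) d₂ e

  copair⇒-inr : ∀ {Δ Ξ} (L : S₁.Ctx) (d₁ : L ⇒ Ξ) (d₂ : Δ ⇒ Ξ) {S} (z : Δ ∋ S) → copair⇒ L d₁ d₂ (inr L z) ≡ d₂ z
  copair⇒-inr [] d₁ d₂ z = refl
  copair⇒-inr (S ∷ L) d₁ d₂ z = copair⇒-inr L (λ w → d₁ (there w)) d₂ z

  -- Rep Δ X: how variables of Δ (old sorts) represent an element of X; Link d X r a is the
  -- Σ₂-formula saying that r, read in Ξ through d, represents a.
  Rep : S₁.Ctx → Sort₂ → Set
  Rep Δ (old S) = Δ ∋ S
  Rep Δ (prod p) = ∀ {S} → prodComps p ∋ S → Δ ∋ S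
  Rep Δ (coprod q) = Σ Sort₁ (λ S → coprodComps q ∋ S × Δ ∋ S)
  Rep Δ (sub s) = Δ ∋ subAmb s
  Rep Δ (quot q) = Δ ∋ quotBase q

  renRep : ∀ {Δ Δ'} (X : Sort₂) → Ren Δ Δ' → Rep Δ X → Rep Δ' X
  renRep (old S) r a = r a
  renRep (prod p) r a = λ v → r (a v)
  renRep (coprod q) r (S , v , a) = S , v , r a
  renRep (sub s) r a = r a
  renRep (quot q) r a = r a

  Env : Ctx → S₁.Ctx → Set
  Env Γ Δ = ∀ {X} → Γ ∋ X → Rep Δ X

  renEnv : ∀ {Γ Δ Δ'} → Ren Δ Δ' → Env Γ Δ → Env Γ Δ'
  renEnv r en {X} y = renRep X r (en y)

  Link : ∀ {Δ Ξ} → Δ ⇒ Ξ → (X : Sort₂) → Rep Δ X → Term Ξ X → Formula Ξ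
  Link d (old S) z a = var (d z) ≐ a
  Link d (prod p) z a = ⋀ (prodComps p) (λ v → app (π p v) (a ∷ []) ≐ var (d (z v)))
  Link d (coprod q) (S , v , z) a = app (ρ q v) (var (d z) ∷ []) ≐ a
  Link d (sub s) z a = app (ι s) (a ∷ []) ≐ var (d z)
  Link d (quot q) z a = app (ε q) (var (d z) ∷ []) ≐ a

  Link-ren : ∀ {Δ Ξ Ξ'} (w : Ren Ξ Ξ') (d : Δ ⇒ Ξ) (X : Sort₂) (z : Rep Δ X) (a : Term Ξ X) →
             renF w (Link d X z a) ≡ Link (λ v → w (d v)) X z (renT w a)
  Link-ren w d (old S) z a = refl
  Link-ren w d (prod p) z a = ⋀-ren w (prodComps p) _
  Link-ren w d (coprod q) (S , v , z) a = refl
  Link-ren w d (sub s) z a = refl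
  Link-ren w d (quot q) z a = refl

  Link-cong : ∀ {Δ Ξ} {d d' : Δ ⇒ Ξ} → DEq d d' → (X : Sort₂) (z : Rep Δ X) (a : Term Ξ X) → Link d X z a ≡ Link d' X z a
  Link-cong e (old S) z a = cong (λ u → var u ≐ a) (e z)
  Link-cong e (prod p) z a = ⋀-cong (prodComps p) (λ v → cong (λ u → app (π p v) (a ∷ []) ≐ var u) (e (z v)))
  Link-cong e (coprod q) (S , v , z) a = cong (λ u → app (ρ q v) (var u ∷ []) ≐ a) (e z)
  Link-cong e (sub s) z a = cong (λ u → app (ι s) (a ∷ []) ≐ var u) (e z)
  Link-cong e (quot q) z a = cong (λ u → app (ε q) (var u ∷ []) ≐ a) (e z)

  Link-renRep : ∀ {Δ Δ' Ξ} (d : Δ' ⇒ Ξ) (r : Ren Δ Δ') (X : Sort₂) (z : Rep Δ X) (a : Term Ξ X) →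
                Link d X (renRep X r z) a ≡ Link (λ v → d (r v)) X z a
  Link-renRep d r (old S) z a = refl
  Link-renRep d r (prod p) z a = refl
  Link-renRep d r (coprod q) (S , v , z) a = refl
  Link-renRep d r (sub s) z a = refl
  Link-renRep d r (quot q) z a = refl

  -- Branch i of X represents its elements by the variables branchCtx X i subject to branchGuard X i.
  branches : Sort₂ → ℕ
  branches (coprod q) = length (coprodComps q)
  branches _ = 1

  branchCtx : (X : Sort₂) → Fin (branches X) → S₁.Ctx
  branchCtx (old S) _ = S ∷ []
  branchCtx (prod p) _ = prodComps p
  branchCtx (coprod q) i = proj₁ (nthPos (coprodComps q) i) ∷ []
  branchCtx (sub s) _ = subAmb s ∷ []
  branchCtx (quot q) _ = quotBase q ∷ []

  branchGuard : (X : Sort₂) (i : Fin (branches X)) → S₁.Formula (branchCtx X i)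
  branchGuard (sub s) _ = subFml s
  branchGuard (old S) _ = S₁.⊤'
  branchGuard (prod p) _ = S₁.⊤'
  branchGuard (coprod q) _ = S₁.⊤'
  branchGuard (quot q) _ = S₁.⊤'

  branchRep : (X : Sort₂) (i : Fin (branches X)) → Rep (branchCtx X i) X
  branchRep (old S) _ = here
  branchRep (prod p) _ = λ v → v
  branchRep (coprod q) i = proj₁ (nthPos (coprodComps q) i) , proj₂ (nthPos (coprodComps q) i) , here
  branchRep (sub s) _ = here
  branchRep (quot q) _ = here

  oldBlockSub : ∀ {Ξ} (ss : S₁.Ctx) → (∀ {S} → ss ∋ S → Term Ξ (old S)) → Sub (map old ss ++ Ξ) Ξ
  oldBlockSub [] g = var
  oldBlockSub (S ∷ ss) g here = g here
  oldBlockSub (S ∷ ss) g (there u) = oldBlockSub ss (λ v → g (there v)) u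

  oldBlockSub-inr : ∀ {Ξ} (ss : S₁.Ctx) (g : ∀ {S} → ss ∋ S → Term Ξ (old S)) {X} (u : Ξ ∋ X) →
                 oldBlockSub ss g (inr (map old ss) u) ≡ var u
  oldBlockSub-inr [] g u = refl
  oldBlockSub-inr (S ∷ ss) g u = oldBlockSub-inr ss (λ v → g (there v)) u

  oldBlockSub-inl : ∀ {Ξ} (ss : S₁.Ctx) (g : ∀ {S} → ss ∋ S → Term Ξ (old S)) {S} (v : ss ∋ S) →
                 oldBlockSub ss g (inl (mapVar old v)) ≡ g v
  oldBlockSub-inl (S ∷ ss) g here = refl
  oldBlockSub-inl (S ∷ ss) g (there v) = oldBlockSub-inl ss (λ w → g (there w)) v

  ∃*-intro-oldBlock : ∀ {Ξ} (ss : S₁.Ctx) (g : ∀ {S} → ss ∋ S → Term Ξ (old S)) (B : Formula (map old ss ++ Ξ)) →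
                Pf T₂ Ξ (subF (oldBlockSub ss g) B) (∃* (map old ss) B)
  ∃*-intro-oldBlock {Ξ} ss g B = castR (subF-inr-cancel (map old ss) (oldBlockSub ss g) (oldBlockSub-inr ss g) (∃* (map old ss) B))
                                 (subst (oldBlockSub ss g) (∃*-intro (map old ss) {B}))

  coprodRepEq : ∀ {Δ} {q : CoprodSort} {S S'} (v : coprodComps q ∋ S) (w : coprodComps q ∋ S') → Δ ∋ S → Δ ∋ S' → S₁.Formula Δ
  coprodRepEq v w a b with cmp v w
  ... | same = S₁.var a S₁.≐ S₁.var b
  ... | diff _ = S₁.⊥'

  RepEq : ∀ {Δ} (X : Sort₂) → Rep Δ X → Rep Δ X → S₁.Formula Δ
  RepEq (old S) a b = S₁.var a S₁.≐ S₁.var b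
  RepEq (prod p) a b = S₁.⋀ (prodComps p) (λ v → S₁.var (a v) S₁.≐ S₁.var (b v))
  RepEq (coprod q) (S , v , a) (S' , w , b) = coprodRepEq v w a b
  RepEq (sub s) a b = S₁.var a S₁.≐ S₁.var b
  RepEq (quot q) a b = S₁.renF (pairRen a b) (quotFml q)

  prodExtSub : ∀ {Ξ Δ} (p : ProdSort) (d : Δ ⇒ Ξ) (r : Rep Δ (prod p)) (a b : Term Ξ (prod p)) →
          Sub (prod p ∷ prod p ∷ map old (prodComps p)) Ξ
  prodExtSub p d r a b here = a
  prodExtSub p d r a b (there here) = b
  prodExtSub p d r a b (there (there u)) = var (unmap (λ v → d (r v)) u)

  prod-ext : ∀ {Ξ Δ} {H : Formula Ξ} (p : ProdSort) (d : Δ ⇒ Ξ) (r : Rep Δ (prod p)) (a b : Term Ξ (prod p)) →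
             Pf T₂ Ξ H (Link d (prod p) r a) → Pf T₂ Ξ H (Link d (prod p) r b) → Pf T₂ Ξ H (a ≐ b)
  prod-ext {Ξ} {Δ} {H} p d r a b la lb =
    ∧-intro (castR (e a here refl) la) (castR (e b (there here) refl) lb) ⟫ axiomInst (ax-prod₂ p) (prodExtSub p d r a b)
    where
      σ = prodExtSub p d r a b
      e : ∀ (c : Term Ξ (prod p)) (x : prod p ∷ prod p ∷ map old (prodComps p) ∋ prod p) → σ x ≡ c →
          Link d (prod p) r c ≡ subF σ (⋀ (prodComps p) (λ v → app (π p v) (var x ∷ []) ≐ var (there (there (mapVar old v)))))
      e c x ex = sym (trans (⋀-sub σ (prodComps p) _)
                   (⋀-cong (prodComps p) (λ v → cong₂ (λ t u → app (π p v) (t ∷ []) ≐ var u) ex (unmap-mapVar (λ w → d (r w)) v))))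

  eq⇔RepEq : ∀ {Δ Ξ} (X : Sort₂) (d : Δ ⇒ Ξ) {H : Formula Ξ} (ra rb : Rep Δ X) (a b : Term Ξ X) →
            Pf T₂ Ξ H (Link d X ra a) → Pf T₂ Ξ H (Link d X rb b) → Equiv H (a ≐ b) (tr⇒ d (RepEq X ra rb))
  eq⇔RepEq (old S) d ra rb a b la lb =
    eq-trans (∧-el₁ ⟫ la) (eq-trans ∧-el₂ (eq-sym (∧-el₁ ⟫ lb))) ,
    eq-trans (eq-sym (∧-el₁ ⟫ la)) (eq-trans ∧-el₂ (∧-el₁ ⟫ lb))
  eq⇔RepEq (sub s) d ra rb a b la lb =
    eq-trans (eq-sym (∧-el₁ ⟫ la)) (eq-trans (eq-cong (app (ι s) (var here ∷ [])) ∧-el₂) (∧-el₁ ⟫ lb)) ,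
    (eq-trans (∧-el₁ ⟫ la) (eq-trans ∧-el₂ (eq-sym (∧-el₁ ⟫ lb))) ⟫ axiomInst (ax-sub₃ s) (sub2 a b))
  eq⇔RepEq {Δ} {Ξ} (quot q) d {H} ra rb a b la lb =
    (eq-trans (∧-el₁ ⟫ la) (eq-trans ∧-el₂ (eq-sym (∧-el₁ ⟫ lb))) ⟫ castR (sym quotFml≡) (axiomInst (ax-quot₁ q) σ)) ,
    eq-trans (eq-sym (∧-el₁ ⟫ la)) (eq-trans (∧-el₂ ⟫ castL (sym quotFml≡) (axiomInst (ax-quot₂ q) σ)) (∧-el₁ ⟫ lb))
    where
      dd : (quotBase q ∷ quotBase q ∷ []) ⇒ Ξ
      dd v = d (pairRen ra rb v)
      σ : Sub (old (quotBase q) ∷ old (quotBase q) ∷ []) Ξ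
      σ v = var (unmap dd v)
      quotFml≡ : tr⇒ d (S₁.renF (pairRen ra rb) (quotFml q)) ≡ subF σ (tr (quotFml q))
      quotFml≡ = trans (tr⇒-renF d (pairRen ra rb) (quotFml q)) (trans (tr⇒≡renF-tr dd (quotFml q)) (renF≡subF (unmap dd) (tr (quotFml q))))
  eq⇔RepEq (prod p) d ra rb a b la lb =
    castR (sym (tr⇒-⋀ d (prodComps p) _))
      (⋀-intro (prodComps p) (λ v → eq-trans (eq-sym (∧-el₁ ⟫ la ⟫ ⋀-elim (prodComps p) v))
          (eq-trans (eq-cong (app (π p v) (var here ∷ [])) ∧-el₂) (∧-el₁ ⟫ lb ⟫ ⋀-elim (prodComps p) v)))) ,
    prod-ext p d ra a b (∧-el₁ ⟫ la)
      (⋀-intro (prodComps p) (λ v → eq-trans (∧-el₁ ⟫ lb ⟫ ⋀-elim (prodComps p) v)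
          (eq-sym (∧-el₂ ⟫ castL (sym (tr⇒-⋀ d (prodComps p) _)) (⋀-elim (prodComps p) v)))))
  eq⇔RepEq (coprod q) d (S , v , x) (S' , w , y) a b la lb with cmp v w
  ... | same =
    ∧-intro (∧-el₁ ⟫ la) (eq-trans (∧-el₁ ⟫ lb) (eq-sym ∧-el₂)) ⟫ axiomInst (ax-coprod₂ q v) (sub3 (var (d x)) (var (d y)) a) ,
    eq-trans (eq-sym (∧-el₁ ⟫ la)) (eq-trans (eq-cong (app (ρ q v) (var here ∷ [])) ∧-el₂) (∧-el₁ ⟫ lb))
  ... | diff ne =
    ∧-intro (∧-el₁ ⟫ la) (eq-trans (∧-el₁ ⟫ lb) (eq-sym ∧-el₂)) ⟫ axiomInst (ax-coprod₃ q v w ne) (sub3 (var (d x)) (var (d y)) a) ,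
    (∧-el₂ ⟫ bot)

  link-unique : ∀ {Δ Ξ} (X : Sort₂) (d : Δ ⇒ Ξ) {H : Formula Ξ} (r : Rep Δ X) (a b : Term Ξ X) →
         Pf T₂ Ξ H (Link d X r a) → Pf T₂ Ξ H (Link d X r b) → Pf T₂ Ξ H (a ≐ b)
  link-unique (old S) d r a b la lb = eq-trans (eq-sym la) lb
  link-unique (prod p) d r a b la lb = prod-ext p d r a b la lb
  link-unique (coprod q) d (S , v , x) a b la lb = eq-trans (eq-sym la) lb
  link-unique (sub s) d r a b la lb = eq-trans la (eq-sym lb) ⟫ axiomInst (ax-sub₃ s) (sub2 a b)
  link-unique (quot q) d r a b la lb = eq-trans (eq-sym la) lb

  inl⇒ : (L : S₁.Ctx) {Ξ : Ctx} → L ⇒ (map old L ++ Ξ)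
  inl⇒ L e = inl (mapVar old e)

  BranchLink : ∀ {Ξ} (X : Sort₂) (a : Term Ξ X) (i : Fin (branches X)) → Formula (map old (branchCtx X i) ++ Ξ)
  BranchLink X a i = tr⇒ (inl⇒ (branchCtx X i)) (branchGuard X i)
                     ∧' Link (inl⇒ (branchCtx X i)) X (branchRep X i) (renT (inr (map old (branchCtx X i))) a)

  BranchCover : ∀ {Ξ} (X : Sort₂) (a : Term Ξ X) (i : Fin (branches X)) → Formula Ξ
  BranchCover X a i = ∃* (map old (branchCtx X i)) (BranchLink X a i)

  branch-cover : ∀ {Ξ} (X : Sort₂) (a : Term Ξ X) → Pf T₂ Ξ ⊤' (⋁ (branches X) (BranchCover X a))
  branch-cover (old S) a = ∧-intro top (castR (cong₂ _≐_ refl (sym (sub0-wkT a a))) (eq-reflT a)) ⟫ ∃-intro a ⟫ ∨-in₁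
  branch-cover (prod p) a = ∧-intro top (castR (sym links≡) (⋀-intro (prodComps p) (λ v → eq-reflT _)))
                   ⟫ ∃*-intro-oldBlock (prodComps p) g _ ⟫ ∨-in₁
    where
      g : ∀ {S} → prodComps p ∋ S → Term _ (old S)
      g v = app (π p v) (a ∷ [])
      σ = oldBlockSub (prodComps p) g
      links≡ : subF σ (⋀ (prodComps p) (λ v → app (π p v) (renT (inr (map old (prodComps p))) a ∷ []) ≐ var (inl (mapVar old v))))
            ≡ ⋀ (prodComps p) (λ v → g v ≐ g v)
      links≡ = trans (⋀-sub σ (prodComps p) _) (⋀-cong (prodComps p) (λ v →
              cong₂ (λ t u → app (π p v) (t ∷ []) ≐ u) (subT-inr-cancel (map old (prodComps p)) σ (oldBlockSub-inr (prodComps p) g) a)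
                (oldBlockSub-inl (prodComps p) g v)))
  branch-cover (coprod q) a = castR (⋁ₗ-sub (sub1 a) (coprodComps q) _) (axiomInst (ax-coprod₁ q) (sub1 a))
                     ⟫ ⋁ₗ→⋁ (coprodComps q) _ ⟫ ⋁-map (length (coprodComps q)) (λ k → ∃-⊤∧)
  branch-cover (sub s) a = ∧-intro (castR (cong₂ _≐_ refl (sym (sub0-wkT a (app (ι s) (a ∷ []))))) (eq-reflT (app (ι s) (a ∷ [])))
                             ⟫ ∃-intro {φ = app (ι s) (var here ∷ []) ≐ renT there (app (ι s) (a ∷ []))} a ⟫ castR (sym guard≡) (axiomInst (ax-sub₂ s) (sub1 (app (ι s) (a ∷ [])))))
                          (castR (cong₂ _≐_ (cong (λ t → app (ι s) (t ∷ [])) (sym (sub0-wkT (app (ι s) (a ∷ [])) a))) refl) (eq-reflT _))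
                  ⟫ ∃-intro (app (ι s) (a ∷ [])) ⟫ ∨-in₁
    where
      guard≡ : subF (sub0 (app (ι s) (a ∷ []))) (tr⇒ (inl⇒ (subAmb s ∷ [])) (subFml s)) ≡ subF (sub1 (app (ι s) (a ∷ []))) (tr (subFml s))
      guard≡ = trans (cong (subF (sub0 (app (ι s) (a ∷ [])))) (tr⇒≡renF-tr (inl⇒ (subAmb s ∷ [])) (subFml s)))
              (trans (subF-ren _ _ (tr (subFml s))) (subF-cong (λ { here → refl ; (there ()) }) (tr (subFml s))))
  branch-cover (quot q) a = axiomInst (ax-quot₃ q) (sub1 a) ⟫ ∃-⊤∧ ⟫ ∨-in₁

  branch-exists : ∀ {Ξ} (X : Sort₂) (i : Fin (branches X)) (d : branchCtx X i ⇒ Ξ) → Pf T₂ Ξ (tr⇒ d (branchGuard X i)) (∃' (Link (λ e → there (d e)) X (branchRep X i) (var here)))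
  branch-exists (old S) i d = eq-reflT _ ⟫ ∃-intro (var (d here))
  branch-exists (prod p) i d = castR (cong ∃' (trans (⋀-ren (ext (unmap d)) (prodComps p) _)
                       (⋀-cong (prodComps p) (λ v → cong (λ u → app (π p v) (var here ∷ []) ≐ var (there u)) (unmap-mapVar d v)))))
                     (renPf (unmap d) (axiom (ax-prod₁ p)))
  branch-exists (coprod q) i d = eq-reflT _ ⟫ ∃-intro (app (ρ q (proj₂ (nthPos (coprodComps q) i))) (var (d here) ∷ []))
  branch-exists (sub s) i d = castL (sym (tr⇒≡renF-tr d (subFml s))) (renPf (unmap d) (axiom (ax-sub₁ s)))
  branch-exists (quot q) i d = eq-reflT _ ⟫ ∃-intro (app (ε q) (var (d here) ∷ []))

  link⇒guard : ∀ {Ξ} (X : Sort₂) (i : Fin (branches X)) (d : branchCtx X i ⇒ Ξ) (a : Term Ξ X) → Pf T₂ Ξ (Link d X (branchRep X i) a) (tr⇒ d (branchGuard X i))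
  link⇒guard (old S) i d a = top
  link⇒guard (prod p) i d a = top
  link⇒guard (coprod q) i d a = top
  link⇒guard (sub s) i d a = ∃-intro a ⟫ castR (sym (tr⇒≡renF-tr d (subFml s))) (renPf (unmap d) (axiom (ax-sub₂ s)))
  link⇒guard (quot q) i d a = top

  oldFun-graph : ∀ {Δ'} (f : Fun₁) → (∀ {S} → fdom₁ f ∋ S → Δ' ∋ S) → S₁.Formula (fcod₁ f ∷ Δ')
  oldFun-graph f ws = S₁.app f (S₁.tab (fdom₁ f) (λ v → S₁.var (there (ws v)))) S₁.≐ S₁.var here

  defFun-graph : ∀ {Δ'} (f : DefFun) → (∀ {S} → defFunDom f ∋ S → Δ' ∋ S) → S₁.Formula (defFunCod f ∷ Δ')
  defFun-graph f ws = S₁.renF (S₁.ext ws) (defFunFml f)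

  -- A term of a new sort has no Σ₁-counterpart, so terms are translated in continuation-passing
  -- style: the continuation receives (in a possibly extended context) the representation of the value.
  TermCont : S₁.Ctx → Sort₂ → Set
  TermCont Δ X = ∀ {Δ'} → Ren Δ Δ' → Rep Δ' X → S₁.Formula Δ'

  TermsCont : S₁.Ctx → S₁.Ctx → Set
  TermsCont Δ ss = ∀ {Δ'} → Ren Δ Δ' → (∀ {S} → ss ∋ S → Δ' ∋ S) → S₁.Formula Δ'

  trTerm : ∀ {Γ Δ X} → Env Γ Δ → Term Γ X → TermCont Δ X → S₁.Formula Δ
  trTerms : ∀ {Γ Δ} (ss : S₁.Ctx) → Env Γ Δ → Terms Γ (map old ss) → TermsCont Δ ss → S₁.Formula Δ
  trTerm en (var y) K = K idRen (en y)
  trTerm en (app (oldF f) ts) K =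
    trTerms (fdom₁ f) en ts (λ r ws → S₁.∃' (oldFun-graph f ws S₁.∧' K (λ v → there (r v)) here))
  trTerm en (app (defF f) ts) K =
    trTerms (defFunDom f) en ts (λ r ws → S₁.∃' (defFun-graph f ws S₁.∧' K (λ v → there (r v)) here))
  trTerm en (app (π p v) (t ∷ [])) K = trTerm en t (λ r rp → K r (rp v))
  trTerm en (app (ρ q v) (t ∷ [])) K = trTerm en t (λ r z → K r (_ , v , z))
  trTerm en (app (ι s) (t ∷ [])) K = trTerm en t K
  trTerm en (app (ε q) (t ∷ [])) K = trTerm en t K
  trTerms [] en [] K = K idRen emptyRen
  trTerms (S ∷ ss) en (t ∷ ts) K = trTerm en t (λ r z → trTerms ss (renEnv r en) ts (λ r' ws → K (λ v → r' (r v)) (consRen (r' z) ws)))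

  extEnv : ∀ {Γ Δ} (X : Sort₂) (i : Fin (branches X)) → Env Γ Δ → Env (X ∷ Γ) (branchCtx X i ++ Δ)
  extEnv X i en here = renRep X inl (branchRep X i)
  extEnv X i en {Y} (there y) = renRep Y (inr (branchCtx X i)) (en y)

  trFormula : ∀ {Γ Δ} → Env Γ Δ → Formula Γ → S₁.Formula Δ
  trFormula en ⊤' = S₁.⊤'
  trFormula en ⊥' = S₁.⊥'
  trFormula en (rel (oldR R) ts) = trTerms (rdom₁ R) en ts (λ r ws → S₁.rel R (S₁.tab (rdom₁ R) (λ v → S₁.var (ws v))))
  trFormula en (rel (defR R) ts) = trTerms (defRelDom R) en ts (λ r ws → S₁.renF ws (defRelFml R))
  trFormula en (_≐_ {X} s t) = trTerm en s (λ r a → trTerm (renEnv r en) t (λ r' b → RepEq X (renRep X r' a) b))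
  trFormula en (φ ∧' ψ) = trFormula en φ S₁.∧' trFormula en ψ
  trFormula en (φ ∨' ψ) = trFormula en φ S₁.∨' trFormula en ψ
  trFormula en (∃' {X} φ) = S₁.⋁ (branches X) (λ i → S₁.∃* (branchCtx X i) (S₁.renF inl (branchGuard X i) S₁.∧' trFormula (extEnv X i en) φ))

  LinksHold : ∀ {Γ Δ Ξ} → Env Γ Δ → Formula Ξ → Ren Γ Ξ → Δ ⇒ Ξ → Set
  LinksHold {Γ} en H γ d = ∀ {X} (y : Γ ∋ X) → Pf T₂ _ H (Link d X (en y) (var (γ y)))

  link-ren : ∀ {Δ Δ' Ξ Ξ'} {H : Formula Ξ} {H' : Formula Ξ'} (X : Sort₂) (d : Δ ⇒ Ξ) (r : Ren Δ Δ') (w : Ren Ξ Ξ') (d' : Δ' ⇒ Ξ') →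
            (∀ {S} (z : Δ ∋ S) → d' (r z) ≡ w (d z)) → Pf T₂ Ξ' H' (renF w H) →
            (rep : Rep Δ X) (a : Term Ξ X) → Pf T₂ Ξ H (Link d X rep a) → Pf T₂ Ξ' H' (Link d' X (renRep X r rep) (renT w a))
  link-ren X d r w d' c hyp rep a la =
    hyp ⟫ castR (trans (Link-ren w d X rep a) (trans (Link-cong (λ z → sym (c z)) X rep (renT w a)) (sym (Link-renRep d' r X rep (renT w a)))))
               (renPf w la)

  LinksHold-ren : ∀ {Γ Δ Δ' Ξ Ξ'} {en : Env Γ Δ} {H : Formula Ξ} {γ : Ren Γ Ξ} {d : Δ ⇒ Ξ} → LinksHold en H γ d →
                (r : Ren Δ Δ') (w : Ren Ξ Ξ') (d' : Δ' ⇒ Ξ') → (∀ {S} (z : Δ ∋ S) → d' (r z) ≡ w (d z)) →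
                (H' : Formula Ξ') → Pf T₂ Ξ' H' (renF w H) → LinksHold (renEnv r en) H' (λ v → w (γ v)) d'
  LinksHold-ren {en = en} {d = d} lk r w d' c H' hyp {X} y = link-ren X d r w d' c hyp (en y) _ (lk y)

  unmap-∘ : ∀ {L Ξ Ξ'} (r : Ren Ξ Ξ') (dd : L ⇒ Ξ) {X} (u : map old L ∋ X) → unmap (λ v → r (dd v)) u ≡ r (unmap dd u)
  unmap-∘ {S ∷ L} r dd here = refl
  unmap-∘ {S ∷ L} r dd (there u) = unmap-∘ r (λ v → dd (there v)) u

  trTs⇒-tab : ∀ {Δ Ξ} (ss : S₁.Ctx) (d : Δ ⇒ Ξ) (g : ∀ {S} → ss ∋ S → Δ ∋ S) →
              trTs⇒ d (S₁.tab ss (λ v → S₁.var (g v))) ≡ tab (map old ss) (λ u → var (unmap (λ v → d (g v)) u))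
  trTs⇒-tab [] d g = refl
  trTs⇒-tab (S ∷ ss) d g = cong₂ _∷_ refl (trTs⇒-tab ss d (λ v → g (there v)))

  argsSub : ∀ {Ξ Ξ'} (ss : S₁.Ctx) → Terms Ξ' (map old ss) → Ren Ξ Ξ' → Sub (map old ss ++ Ξ) Ξ'
  argsSub [] [] w v = var (w v)
  argsSub (S ∷ ss) (t ∷ ts) w here = t
  argsSub (S ∷ ss) (t ∷ ts) w (there v) = argsSub ss ts w v

  argVars : ∀ {Δ' Ξ'} (ss : S₁.Ctx) → Δ' ⇒ Ξ' → (∀ {S} → ss ∋ S → Δ' ∋ S) → Terms Ξ' (map old ss)
  argVars ss d ws = tab (map old ss) (λ u → var (unmap (λ v → d (ws v)) u))

  argsSub-inr : ∀ {Ξ Ξ'} (ss : S₁.Ctx) (us : Terms Ξ' (map old ss)) (w : Ren Ξ Ξ') {X} (u : Ξ ∋ X) → argsSub ss us w (inr (map old ss) u) ≡ var (w u)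
  argsSub-inr [] [] w u = refl
  argsSub-inr (S ∷ ss) (t ∷ ts) w u = argsSub-inr ss ts w u

  argsSub-tab-inl : ∀ {Ξ Ξ'} (ss : S₁.Ctx) (us : Terms Ξ' (map old ss)) (w : Ren Ξ Ξ') → tab (map old ss) (λ u → argsSub ss us w (inl u)) ≡ us
  argsSub-tab-inl [] [] w = refl
  argsSub-tab-inl (S ∷ ss) (t ∷ ts) w = cong₂ _∷_ refl (argsSub-tab-inl ss ts w)

  argsSub-vars : ∀ {Ξ Ξ'} (ss : S₁.Ctx) (us : Terms Ξ' (map old ss)) (w : Ren Ξ Ξ') → subTs (argsSub ss us w) (tab (map old ss) (λ u → var (inl u))) ≡ us
  argsSub-vars ss us w = trans (subTs-tab (map old ss) (argsSub ss us w) _) (argsSub-tab-inl ss us w)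

  argsSub-ren : ∀ {Ξ' Ξ''} (ss : S₁.Ctx) (us : Terms Ξ' (map old ss)) (w : Ren Ξ' Ξ'') {X} (u : (map old ss ++ Ξ') ∋ X) →
           renT w (argsSub ss us idRen u) ≡ argsSub ss (renTs w us) idRen (liftRen (map old ss) w u)
  argsSub-ren [] [] w u = refl
  argsSub-ren (S ∷ ss) (t ∷ ts) w here = refl
  argsSub-ren (S ∷ ss) (t ∷ ts) w (there u) = argsSub-ren ss ts w u

  argsSub-lift : ∀ {Ξ Ξ' Ξ''} (ss : S₁.Ctx) (us : Terms Ξ'' (map old ss)) (w : Ren Ξ Ξ') (w' : Ren Ξ' Ξ'') {X} (u : (map old ss ++ Ξ) ∋ X) →
            argsSub ss us w' (liftRen (map old ss) w u) ≡ argsSub ss us (λ v → w' (w v)) u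
  argsSub-lift [] [] w w' u = refl
  argsSub-lift (S ∷ ss) (t ∷ ts) w w' here = refl
  argsSub-lift (S ∷ ss) (t ∷ ts) w w' (there u) = argsSub-lift ss ts w w' u

  -- Soundness of the translation, relative to any hypothesis H under which the environment links to
  -- the actual variables; it is stated for all later extensions of the contexts, so that it survives
  -- the quantifiers that name intermediate values.
  TermContSound : ∀ {Δ Ξ X} (H : Formula Ξ) (d : Δ ⇒ Ξ) (P : Formula (X ∷ Ξ)) (K : TermCont Δ X) → Set
  TermContSound {Δ} {Ξ} {X} H d P K = ∀ {Δ' Ξ'} (r : Ren Δ Δ') (w : Ren Ξ Ξ') (d' : Δ' ⇒ Ξ') →
     (∀ {S} (z : Δ ∋ S) → d' (r z) ≡ w (d z)) → (H' : Formula Ξ') → Pf T₂ Ξ' H' (renF w H) →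
     (rep : Rep Δ' X) (a : Term Ξ' X) → Pf T₂ Ξ' H' (Link d' X rep a) →
     Equiv H' (subF (headSub a w) P) (tr⇒ d' (K r rep))

  TermSound : ∀ {Γ X} (t : Term Γ X) → Set
  TermSound {Γ} {X} t = ∀ {Δ} (en : Env Γ Δ) {Ξ} (H : Formula Ξ) (γ : Ren Γ Ξ) (d : Δ ⇒ Ξ) → LinksHold en H γ d →
     (P : Formula (X ∷ Ξ)) (K : TermCont Δ X) → TermContSound H d P K → Equiv H (subF (headSub (renT γ t) idRen) P) (tr⇒ d (trTerm en t K))

  TermsContSound : ∀ {Δ Ξ} (ss : S₁.Ctx) (H : Formula Ξ) (d : Δ ⇒ Ξ) (P : Formula (map old ss ++ Ξ)) (K : TermsCont Δ ss) → Set
  TermsContSound {Δ} {Ξ} ss H d P K = ∀ {Δ' Ξ'} (r : Ren Δ Δ') (w : Ren Ξ Ξ') (d' : Δ' ⇒ Ξ') →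
     (∀ {S} (z : Δ ∋ S) → d' (r z) ≡ w (d z)) → (H' : Formula Ξ') → Pf T₂ Ξ' H' (renF w H) →
     (ws : ∀ {S} → ss ∋ S → Δ' ∋ S) → Equiv H' (subF (argsSub ss (argVars ss d' ws) w) P) (tr⇒ d' (K r ws))

  TermsSound : ∀ {Γ} (ss : S₁.Ctx) (ts : Terms Γ (map old ss)) → Set
  TermsSound {Γ} ss ts = ∀ {Δ} (en : Env Γ Δ) {Ξ} (H : Formula Ξ) (γ : Ren Γ Ξ) (d : Δ ⇒ Ξ) → LinksHold en H γ d →
     (P : Formula (map old ss ++ Ξ)) (K : TermsCont Δ ss) → TermsContSound ss H d P K → Equiv H (subF (argsSub ss (renTs γ ts) idRen) P) (tr⇒ d (trTerms ss en ts K))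

  name-term-equiv : ∀ {Ξ Ξ' S} {H' : Formula Ξ'} (cT : Term Ξ' (old S)) (P : Formula (old S ∷ Ξ)) (w : Ren Ξ Ξ')
           (Fm Kf : Formula (old S ∷ Ξ')) →
           Pf T₂ (old S ∷ Ξ') Fm (renT there cT ≐ var here) → Pf T₂ Ξ' ⊤' (subF (sub0 cT) Fm) →
           Equiv (wk H' ∧' Fm) (subF (headSub (var here) (λ v → there (w v))) P) Kf →
           Equiv H' (subF (headSub cT w) P) (∃' (Fm ∧' Kf))
  name-term-equiv {H' = H'} cT P w Fm Kf p1 p2 (k1 , k2) =
    (∧-intro idt (top ⟫ p2 ⟫ ∃-intro cT) ⟫ ∃-elimH (∧-intro ∧-el₂ kf ⟫ ∃-intro-here)) ,
    ∃-elimH (∧-intro idt pv' ⟫ eq-rewrite-headSub (λ v → there (w v)) P (eq-sym (∧-el₂ ⟫ ∧-el₁ ⟫ p1)) ⟫ ≡⇒Pf (sym (renF-headSub there cT w P)))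
    where
      hc = ∧-intro (∧-el₁ ⟫ ∧-el₁) ∧-el₂
      pv = ∧-intro idt (∧-el₁ ⟫ ∧-el₂ ⟫ ≡⇒Pf (renF-headSub there cT w P)) ⟫ eq-rewrite-headSub (λ v → there (w v)) P (∧-el₂ ⟫ p1)
      kf = ∧-intro hc pv ⟫ k1
      hc' = ∧-intro ∧-el₁ (∧-el₂ ⟫ ∧-el₁)
      pv' = ∧-intro hc' (∧-el₂ ⟫ ∧-el₂) ⟫ k2

  plugArgs : ∀ {Ξ Y} (ss : S₁.Ctx) (mk : ∀ {Θ} → Terms Θ (map old ss) → Term Θ Y) → Sub (Y ∷ Ξ) (map old ss ++ Ξ)
  plugArgs ss mk here = mk (tab (map old ss) (λ u → var (inl u)))
  plugArgs ss mk (there u) = var (inr (map old ss) u)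

  argsSub-plugArgs : ∀ {Ξ Ξ' Y} (ss : S₁.Ctx) (mk : ∀ {Θ} → Terms Θ (map old ss) → Term Θ Y) →
           (∀ {Θ Θ'} (σ : Sub Θ Θ') (us : Terms Θ (map old ss)) → subT σ (mk us) ≡ mk (subTs σ us)) →
           (us : Terms Ξ' (map old ss)) (w : Ren Ξ Ξ') (P : Formula (Y ∷ Ξ)) →
           subF (argsSub ss us w) (subF (plugArgs ss mk) P) ≡ subF (headSub (mk us) w) P
  argsSub-plugArgs ss mk nat us w P = trans (subF-comp _ _ P) (subF-cong (λ { here → trans (nat _ _) (cong mk (argsSub-vars ss us w)) ; (there u) → argsSub-inr ss us w u }) P)

  unary-sound : ∀ {Γ X Y} (mk : ∀ {Θ} → Term Θ X → Term Θ Y) →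
                (∀ {Θ Θ'} (σ : Sub Θ Θ') (a : Term Θ X) → subT σ (mk a) ≡ mk (subT σ a)) →
                (rep : ∀ {Δ} → Rep Δ X → Rep Δ Y) →
                (∀ {Δ Ξ} {H : Formula Ξ} (d : Δ ⇒ Ξ) (z : Rep Δ X) (a : Term Ξ X) →
                   Pf T₂ Ξ H (Link d X z a) → Pf T₂ Ξ H (Link d Y (rep z) (mk a))) →
                (t : Term Γ X) → TermSound t →
                ∀ {Δ} (en : Env Γ Δ) {Ξ} (H : Formula Ξ) (γ : Ren Γ Ξ) (d : Δ ⇒ Ξ) → LinksHold en H γ d →
                (P : Formula (Y ∷ Ξ)) (K : TermCont Δ Y) → TermContSound H d P K →
                Equiv H (subF (headSub (mk (renT γ t)) idRen) P) (tr⇒ d (trTerm en t (λ r z → K r (rep z))))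
  unary-sound {X = X} mk mk-sub rep link t ih en H γ d lk P K ks =
    castEquiv (plug (renT γ t) idRen) refl
      (ih en H γ d lk (subF (replaceHead (mk (var here))) P) _
        (λ r w d' c H' hyp z a la →
          castEquiv (sym (plug a w)) refl (ks r w d' c H' hyp (rep z) (mk a) (link d' z a la))))
    where
      plug : ∀ {Ξ'} (a : Term Ξ' X) (w : Ren _ Ξ') →
             subF (headSub a w) (subF (replaceHead (mk (var here))) P) ≡ subF (headSub (mk a) w) P
      plug a w = trans (headSub-replaceHead a w (mk (var here)) P)
                       (cong (λ u → subF (headSub u w) P) (mk-sub (headSub a w) (var here)))

  funApp-sound : ∀ {Γ S} (ss : S₁.Ctx) (mk : ∀ {Θ} → Terms Θ (map old ss) → Term Θ (old S)) →
                 (∀ {Θ Θ'} (σ : Sub Θ Θ') (us : Terms Θ (map old ss)) → subT σ (mk us) ≡ mk (subTs σ us)) →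
                 (G : ∀ {Δ'} → (∀ {S'} → ss ∋ S' → Δ' ∋ S') → S₁.Formula (S ∷ Δ')) →
                 (∀ {Δ' Ξ'} (d' : Δ' ⇒ Ξ') (ws : ∀ {S'} → ss ∋ S' → Δ' ∋ S') →
                    PfEq T₂ (old S ∷ Ξ') (tr⇒ (ext⇒ d') (G ws)) (renT there (mk (argVars ss d' ws)) ≐ var here)) →
                 (ts : Terms Γ (map old ss)) → TermsSound ss ts →
                 ∀ {Δ} (en : Env Γ Δ) {Ξ} (H : Formula Ξ) (γ : Ren Γ Ξ) (d : Δ ⇒ Ξ) → LinksHold en H γ d →
                 (P : Formula (old S ∷ Ξ)) (K : TermCont Δ (old S)) → TermContSound H d P K →
                 Equiv H (subF (headSub (mk (renTs γ ts)) idRen) P)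
                         (tr⇒ d (trTerms ss en ts (λ r ws → S₁.∃' (G ws S₁.∧' K (λ v → there (r v)) here))))
  funApp-sound ss mk mk-sub G defines ts ih en H γ d lk P K ks =
    castEquiv (argsSub-plugArgs ss mk mk-sub (renTs γ ts) idRen P) refl
      (ih en H γ d lk (subF (plugArgs ss mk) P) _
        (λ r w d' c H' hyp ws →
          castEquiv (sym (argsSub-plugArgs ss mk mk-sub (argVars ss d' ws) w P)) refl
            (name-term-equiv (mk (argVars ss d' ws)) P w _ _ (proj₁ (defines d' ws)) (graph-holds d' ws)
               (ks (λ v → there (r v)) (λ v → there (w v)) (ext⇒ d') (λ z → cong there (c z)) _
                   (hyp-renF-comp w there hyp ∧-el₁) here (var here) (eq-reflT _)))))
    where
      graph-holds : ∀ {Δ' Ξ'} (d' : Δ' ⇒ Ξ') (ws : ∀ {S'} → ss ∋ S' → Δ' ∋ S') →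
                    Pf T₂ Ξ' ⊤' (subF (sub0 (mk (argVars ss d' ws))) (tr⇒ (ext⇒ d') (G ws)))
      graph-holds d' ws = castR (cong₂ _≐_ (sym (sub0-wkT cT cT)) refl) (eq-reflT cT)
                          ⟫ subst (sub0 cT) (proj₂ (defines d' ws))
        where cT = mk (argVars ss d' ws)

  oldFun-defines : ∀ (f : Fun₁) {Δ' Ξ'} (d' : Δ' ⇒ Ξ') (ws : ∀ {S} → fdom₁ f ∋ S → Δ' ∋ S) →
                   PfEq T₂ (old (fcod₁ f) ∷ Ξ') (tr⇒ (ext⇒ d') (oldFun-graph f ws))
                     (renT there (app (oldF f) (argVars (fdom₁ f) d' ws)) ≐ var here)
  oldFun-defines f d' ws = ≡⇒Pf graph≡ , ≡⇒Pf (sym graph≡)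
    where
      ss = fdom₁ f
      graph≡ : tr⇒ (ext⇒ d') (oldFun-graph f ws) ≡ (renT there (app (oldF f) (argVars ss d' ws)) ≐ var here)
      graph≡ = cong (λ u → app (oldF f) u ≐ var here)
        (trans (trTs⇒-tab ss (ext⇒ d') (λ v → there (ws v)))
          (sym (trans (renTs-tab (map old ss) there _) (tab-cong (map old ss) (λ u → cong var (sym (unmap-∘ there (λ v → d' (ws v)) u)))))))

  defFun-defines : ∀ (f : DefFun) {Δ' Ξ'} (d' : Δ' ⇒ Ξ') (ws : ∀ {S} → defFunDom f ∋ S → Δ' ∋ S) →
                   PfEq T₂ (old (defFunCod f) ∷ Ξ') (tr⇒ (ext⇒ d') (defFun-graph f ws))
                     (renT there (app (defF f) (argVars (defFunDom f) d' ws)) ≐ var here)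
  defFun-defines f {Δ'} {Ξ'} d' ws =
    castL (sym graph≡) (castR app≡ (renPf (unmap dd) (axiom (ax-fun₂ f)))) ,
    castL app≡ (castR (sym graph≡) (renPf (unmap dd) (axiom (ax-fun₁ f))))
    where
      ss = defFunDom f
      dd : (defFunCod f ∷ ss) ⇒ (old (defFunCod f) ∷ Ξ')
      dd v = ext⇒ d' (S₁.ext ws v)
      graph≡ : tr⇒ (ext⇒ d') (defFun-graph f ws) ≡ renF (unmap dd) (tr (defFunFml f))
      graph≡ = trans (tr⇒-renF (ext⇒ d') (S₁.ext ws) (defFunFml f)) (tr⇒≡renF-tr dd (defFunFml f))
      app≡ : renF (unmap dd) (app (defF f) (tab (map old ss) (λ v → var (there v))) ≐ var here)
             ≡ (renT there (app (defF f) (argVars ss d' ws)) ≐ var here)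
      app≡ = cong (λ u → app (defF f) u ≐ var here)
        (trans (renTs-tab (map old ss) (unmap dd) _)
          (trans (tab-cong (map old ss) (λ u → cong var (unmap-∘ there (λ v → d' (ws v)) u)))
            (sym (renTs-tab (map old ss) there _))))

  trTerm-sound : ∀ {Γ X} (t : Term Γ X) → TermSound t
  trTerms-sound : ∀ {Γ} (ss : S₁.Ctx) (ts : Terms Γ (map old ss)) → TermsSound ss ts

  trTerm-sound (var y) en H γ d lk P K ks = ks idRen idRen d (λ z → refl) H (hyp-renF-id H) (en y) (var (γ y)) (lk y)
  trTerm-sound (app (π p v) (t ∷ [])) =
    unary-sound (λ a → app (π p v) (a ∷ [])) (λ _ _ → refl) (λ z → z v)
                (λ d z a la → eq-sym (la ⟫ ⋀-elim (prodComps p) v)) t (trTerm-sound t)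
  trTerm-sound (app (ρ q v) (t ∷ [])) =
    unary-sound (λ a → app (ρ q v) (a ∷ [])) (λ _ _ → refl) (λ z → _ , v , z)
                (λ d z a la → eq-cong (app (ρ q v) (var here ∷ [])) la) t (trTerm-sound t)
  trTerm-sound (app (ι s) (t ∷ [])) =
    unary-sound (λ a → app (ι s) (a ∷ [])) (λ _ _ → refl) (λ z → z)
                (λ d z a la → eq-sym la) t (trTerm-sound t)
  trTerm-sound (app (ε q) (t ∷ [])) =
    unary-sound (λ a → app (ε q) (a ∷ [])) (λ _ _ → refl) (λ z → z)
                (λ d z a la → eq-cong (app (ε q) (var here ∷ [])) la) t (trTerm-sound t)
  trTerm-sound (app (oldF f) ts) =
    funApp-sound (fdom₁ f) (app (oldF f)) (λ _ _ → refl) (oldFun-graph f) (oldFun-defines f) ts (trTerms-sound (fdom₁ f) ts)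
  trTerm-sound (app (defF f) ts) =
    funApp-sound (defFunDom f) (app (defF f)) (λ _ _ → refl) (defFun-graph f) (defFun-defines f) ts (trTerms-sound (defFunDom f) ts)

  trTerms-sound [] [] en H γ d lk P K ks = ks idRen idRen d (λ z → refl) H (hyp-renF-id H) emptyRen
  trTerms-sound (S ∷ ss) (t ∷ ts) en {Ξ} H γ d lk P K ks =
    castEquiv args≡ refl (trTerm-sound t en H γ d lk (subF τ P) _ headCont)
    where
      τ : Sub (old S ∷ map old ss ++ Ξ) (old S ∷ Ξ)
      τ here = var here
      τ (there u) = renT there (argsSub ss (renTs γ ts) idRen u)
      args≡ : subF (headSub (renT γ t) idRen) (subF τ P) ≡ subF (argsSub (S ∷ ss) (renTs γ (t ∷ ts)) idRen) P
      args≡ = trans (subF-comp _ τ P) (subF-cong (λ { here → refl ; (there u) → trans (headSub-wkT (renT γ t) idRen _) (renT-id _) }) P)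
      headCont : TermContSound H d (subF τ P) (λ r z → trTerms ss (renEnv r en) ts (λ r' ws → K (λ v → r' (r v)) (consRen (r' z) ws)))
      headCont r w d' c H' hyp z a la =
        equiv-trans (eq-rewrite-equiv w (subF τ P) (eq-sym la))
          (castEquiv (sym tailArgs≡) refl
            (trTerms-sound ss ts (renEnv r en) H' (λ v → w (γ v)) d' (LinksHold-ren lk r w d' c H' hyp) (subF τ₂ P) _
              (λ r' w' d'' c' H'' hyp' ws →
                castEquiv (sym (consArgs≡ {w' = w'} {d'' = d''} {r' = r'} {ws = ws} c')) refl
                  (ks (λ v → r' (r v)) (λ v → w' (w v)) d'' (λ x → trans (c' (r x)) (cong w' (c x))) H''
                      (hyp-renF-comp w w' hyp hyp') (consRen (r' z) ws)))))
        where
          τ₂ : Sub (old S ∷ map old ss ++ Ξ) (map old ss ++ _)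
          τ₂ here = var (inr (map old ss) (d' z))
          τ₂ (there u) = var (liftRen (map old ss) w u)
          tailArgs≡ : subF (headSub (var (d' z)) w) (subF τ P) ≡ subF (argsSub ss (renTs (λ v → w (γ v)) ts) idRen) (subF τ₂ P)
          tailArgs≡ = trans (subF-comp _ τ P) (sym (trans (subF-comp _ τ₂ P) (subF-cong
                  (λ { here → argsSub-inr ss _ idRen (d' z)
                     ; (there u) → sym (trans (headSub-wkT (var (d' z)) w _)
                          (trans (argsSub-ren ss (renTs γ ts) w u) (cong (λ us → argsSub ss us idRen (liftRen (map old ss) w u)) (renTs-comp w γ ts)))) }) P)))
          consArgs≡ : ∀ {Δ'' Ξ''} {w' : Ren _ Ξ''} {d'' : Δ'' ⇒ Ξ''} {r' : Ren _ Δ''} {ws : ∀ {S'} → ss ∋ S' → Δ'' ∋ S'} →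
                (∀ {S'} (x : _ ∋ S') → d'' (r' x) ≡ w' (d' x)) →
                subF (argsSub ss (argVars ss d'' ws) w') (subF τ₂ P) ≡ subF (argsSub (S ∷ ss) (argVars (S ∷ ss) d'' (consRen (r' z) ws)) (λ v → w' (w v))) P
          consArgs≡ {w' = w'} {d'' = d''} {r' = r'} {ws = ws} c' = trans (subF-comp _ τ₂ P) (subF-cong
                (λ { here → trans (argsSub-inr ss (argVars ss d'' ws) w' (d' z)) (cong var (sym (c' z)))
                   ; (there u) → argsSub-lift ss (argVars ss d'' ws) w w' u }) P)

  FormulaSound : ∀ {Γ} (φ : Formula Γ) → Set
  FormulaSound {Γ} φ = ∀ {Δ} (en : Env Γ Δ) {Ξ} (H : Formula Ξ) (γ : Ren Γ Ξ) (d : Δ ⇒ Ξ) → LinksHold en H γ d →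
                Equiv H (renF γ φ) (tr⇒ d (trFormula en φ))

  ∃*-intro-tr⇒ : ∀ {Δ Ξ'} (L : S₁.Ctx) (B : S₁.Formula (L ++ Δ)) (d₀ : Δ ⇒ Ξ') (e : L ⇒ Ξ') →
              Pf T₂ Ξ' (tr⇒ (copair⇒ L e d₀) B) (∃* (map old L) (tr⇒ (lift⇒ L d₀) B))
  ∃*-intro-tr⇒ {Δ} {Ξ'} L B d₀ e = castL eqL' (castR eqR' (renPf c (∃*-intro (map old L) {tr⇒ (lift⇒ L d₀) B})))
    where
      c : Ren (map old L ++ Ξ') Ξ'
      c = copair (map old L) (unmap e) idRen
      eqL' : renF c (tr⇒ (lift⇒ L d₀) B) ≡ tr⇒ (copair⇒ L e d₀) B
      eqL' = trans (renF-tr⇒ c _ B) (tr⇒-cong (++-ext L {C = λ S → Ξ' ∋ old S} (λ v → c (lift⇒ L d₀ v)) (copair⇒ L e d₀)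
               (λ x → trans (cong c (lift⇒-inl L d₀ x)) (trans (copair-inl (map old L) (unmap e) idRen (mapVar old x)) (trans (unmap-mapVar e x) (sym (copair⇒-inl L e d₀ x)))))
               (λ z → trans (cong c (lift⇒-inr L d₀ z)) (trans (copair-inr (map old L) (unmap e) idRen (d₀ z)) (sym (copair⇒-inr L e d₀ z))))) B)
      eqR' : ∀ {X : Formula Ξ'} → renF c (renF (inr (map old L)) X) ≡ X
      eqR' {X} = trans (renF-comp c (inr _) X) (trans (renF-cong (copair-inr (map old L) (unmap e) idRen) X) (renF-id X))

  branchBody : ∀ {Γ Δ} (X : Sort₂) (i : Fin (branches X)) → Env Γ Δ → Formula (X ∷ Γ) → S₁.Formula (branchCtx X i ++ Δ)
  branchBody X i en φ = S₁.renF inl (branchGuard X i) S₁.∧' trFormula (extEnv X i en) φ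

  tr⇒-trFormula-∃ : ∀ {Γ Δ Ξ X} (en : Env Γ Δ) (φ : Formula (X ∷ Γ)) (d : Δ ⇒ Ξ) →
                    tr⇒ d (trFormula en (∃' φ))
                      ≡ ⋁ (branches X) (λ i → ∃* (map old (branchCtx X i)) (tr⇒ (lift⇒ (branchCtx X i) d) (branchBody X i en φ)))
  tr⇒-trFormula-∃ {X = X} en φ d =
    trans (tr⇒-⋁ d (branches X) _) (⋁-cong (branches X) (λ i → tr⇒-∃* d (branchCtx X i) (branchBody X i en φ)))

  trFormula-∃-forward : ∀ {Γ Δ X} (φ : Formula (X ∷ Γ)) → FormulaSound φ →
                        (en : Env Γ Δ) {Ξ : Ctx} (H : Formula Ξ) (γ : Ren Γ Ξ) (d : Δ ⇒ Ξ) → LinksHold en H γ d →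
                        (i : Fin (branches X)) →
                        Pf T₂ (X ∷ Ξ) ((wk H ∧' renF (ext γ) φ) ∧' BranchCover X (var here) i) (wk (tr⇒ d (trFormula en (∃' φ))))
  trFormula-∃-forward {X = X} φ ih en {Ξ} H γ d lk i =
    ∃*-elimH Ei' (body ⟫ ≡⇒Pf (tr⇒-cong d₁≗ (branchBody X i en φ))
                 ⟫ ∃*-intro-tr⇒ (branchCtx X i) (branchBody X i en φ) d₀ (inl⇒ (branchCtx X i))
                 ⟫ ⋁-intro (branches X) i ⟫ ≡⇒Pf (sym (tr⇒-trFormula-∃ en φ d₀)) ⟫ ≡⇒Pf goal≡)
    where
      Ei' = map old (branchCtx X i)
      d₀ : _ ⇒ (Ei' ++ X ∷ Ξ)
      d₀ z = inr Ei' (there (d z))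
      H₁ = renF (inr Ei') (wk H) ∧' (tr⇒ (inl⇒ (branchCtx X i)) (branchGuard X i)
                                      ∧' Link (inl⇒ (branchCtx X i)) X (branchRep X i) (var (inr Ei' here)))
      γ₁ : Ren (X ∷ _) (Ei' ++ X ∷ Ξ)
      γ₁ v = inr Ei' (ext γ v)
      d₁ = lift⇒ (branchCtx X i) (λ z → there (d z))
      d₁≗ : DEq d₁ (copair⇒ (branchCtx X i) (inl⇒ (branchCtx X i)) d₀)
      d₁≗ = ++-ext (branchCtx X i) {C = λ S → (Ei' ++ X ∷ Ξ) ∋ old S} d₁ (copair⇒ (branchCtx X i) (inl⇒ (branchCtx X i)) d₀)
              (λ x → trans (lift⇒-inl (branchCtx X i) _ x) (sym (copair⇒-inl (branchCtx X i) (inl⇒ (branchCtx X i)) d₀ x)))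
              (λ z → trans (lift⇒-inr (branchCtx X i) _ z) (sym (copair⇒-inr (branchCtx X i) (inl⇒ (branchCtx X i)) d₀ z)))
      lk₁ : LinksHold (extEnv X i en) H₁ γ₁ d₁
      lk₁ here = ∧-el₂ ⟫ ∧-el₂ ⟫ ≡⇒Pf (sym (trans (Link-renRep d₁ inl X (branchRep X i) _) (Link-cong (lift⇒-inl (branchCtx X i) _) X (branchRep X i) _)))
      lk₁ (there {Y} y) = ∧-el₁ ⟫ ≡⇒Pf (renF-comp (inr Ei') there H) ⟫ renPf (λ v → inr Ei' (there v)) (lk y)
                  ⟫ ≡⇒Pf (trans (Link-ren (λ v → inr Ei' (there v)) d Y (en y) _)
                         (trans (Link-cong (λ z → sym (lift⇒-inr (branchCtx X i) (λ z' → there (d z')) z)) Y (en y) _)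
                                (sym (Link-renRep d₁ (inr (branchCtx X i)) Y (en y) _))))
      guard≡ : tr⇒ d₁ (S₁.renF inl (branchGuard X i)) ≡ tr⇒ (inl⇒ (branchCtx X i)) (branchGuard X i)
      guard≡ = trans (tr⇒-renF d₁ inl (branchGuard X i)) (tr⇒-cong (lift⇒-inl (branchCtx X i) _) (branchGuard X i))
      body = ∧-intro (∧-el₂ ⟫ ∧-el₁ ⟫ ≡⇒Pf (sym guard≡))
                     (∧-intro (∧-intro (∧-el₁ ⟫ ∧-el₁) ∧-el₂) (∧-el₁ ⟫ ∧-el₂ ⟫ ≡⇒Pf (renF-comp (inr Ei') (ext γ) φ))
                      ⟫ proj₁ (ih (extEnv X i en) H₁ γ₁ d₁ lk₁))
      goal≡ : tr⇒ d₀ (trFormula en (∃' φ)) ≡ renF (inr Ei') (wk (tr⇒ d (trFormula en (∃' φ))))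
      goal≡ = sym (trans (renF-comp (inr Ei') there _) (renF-tr⇒ _ d _))

  trFormula-∃-backward : ∀ {Γ Δ X} (φ : Formula (X ∷ Γ)) → FormulaSound φ →
                         (en : Env Γ Δ) {Ξ : Ctx} (H : Formula Ξ) (γ : Ren Γ Ξ) (d : Δ ⇒ Ξ) → LinksHold en H γ d →
                         (i : Fin (branches X)) →
                         Pf T₂ Ξ (H ∧' ∃* (map old (branchCtx X i)) (tr⇒ (lift⇒ (branchCtx X i) d) (branchBody X i en φ)))
                                 (∃' (renF (ext γ) φ))
  trFormula-∃-backward {X = X} φ ih en {Ξ} H γ d lk i = ∃*-elimH Ei' (∧-intro idt witness ⟫ ∃-elimH body)
    where
      Ei' = map old (branchCtx X i)
      d₂ = lift⇒ (branchCtx X i) d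
      witness = ∧-el₂ ⟫ ∧-el₁ ⟫ ≡⇒Pf (tr⇒-renF d₂ inl (branchGuard X i)) ⟫ branch-exists X i (λ e → d₂ (inl e))
      H₃ = wk (renF (inr Ei') H) ∧' Link (λ e → there (d₂ (inl e))) X (branchRep X i) (var here)
      γ₃ : Ren (X ∷ _) (X ∷ Ei' ++ Ξ)
      γ₃ = ext (λ v → inr Ei' (γ v))
      d₃ : _ ⇒ (X ∷ Ei' ++ Ξ)
      d₃ v = there (d₂ v)
      lk₃ : LinksHold (extEnv X i en) H₃ γ₃ d₃
      lk₃ here = ∧-el₂ ⟫ ≡⇒Pf (sym (Link-renRep d₃ inl X (branchRep X i) (var here)))
      lk₃ (there {Y} y) = ∧-el₁ ⟫ ≡⇒Pf (renF-comp there (inr Ei') H) ⟫ renPf (λ v → there (inr Ei' v)) (lk y)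
                  ⟫ ≡⇒Pf (trans (Link-ren (λ v → there (inr Ei' v)) d Y (en y) _)
                         (trans (Link-cong (λ z → sym (cong there (lift⇒-inr (branchCtx X i) d z))) Y (en y) _)
                                (sym (Link-renRep d₃ (inr (branchCtx X i)) Y (en y) _))))
      goal≡ : wk (∃' (renF γ₃ φ)) ≡ wk (renF (inr Ei') (∃' (renF (ext γ) φ)))
      goal≡ = cong (λ z → wk (∃' z)) (sym (trans (renF-comp _ _ φ) (renF-cong (λ { here → refl ; (there v) → refl }) φ)))
      body = ∧-intro (∧-intro (∧-el₁ ⟫ ∧-el₁) ∧-el₂) (∧-el₁ ⟫ ∧-el₂ ⟫ ∧-el₂ ⟫ ≡⇒Pf (renF-tr⇒ there d₂ _))
             ⟫ proj₂ (ih (extEnv X i en) H₃ γ₃ d₃ lk₃) ⟫ ∃-intro-here ⟫ ≡⇒Pf goal≡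

  trFormula-sound : ∀ {Γ} (φ : Formula Γ) → FormulaSound φ
  trFormula-sound ⊤' en H γ d lk = top , top
  trFormula-sound ⊥' en H γ d lk = ∧-el₂ , ∧-el₂
  trFormula-sound (φ ∧' ψ) en H γ d lk with trFormula-sound φ en H γ d lk | trFormula-sound ψ en H γ d lk
  ... | a1 , a2 | b1 , b2 = ∧-intro (∧-map idt ∧-el₁ ⟫ a1) (∧-map idt ∧-el₂ ⟫ b1) , ∧-intro (∧-map idt ∧-el₁ ⟫ a2) (∧-map idt ∧-el₂ ⟫ b2)
  trFormula-sound (φ ∨' ψ) en H γ d lk with trFormula-sound φ en H γ d lk | trFormula-sound ψ en H γ d lk
  ... | a1 , a2 | b1 , b2 = ∨-elimH (a1 ⟫ ∨-in₁) (b1 ⟫ ∨-in₂) , ∨-elimH (a2 ⟫ ∨-in₁) (b2 ⟫ ∨-in₂)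
  trFormula-sound (rel (oldR R) ts) en H γ d lk =
    castEquiv (cong (rel (oldR R)) (argsSub-vars ss _ idRen)) refl
      (trTerms-sound ss ts en H γ d lk (rel (oldR R) (tab (map old ss) (λ u → var (inl u)))) _
        (λ r w d' c H' hyp ws → (∧-el₂ ⟫ ≡⇒Pf (atom≡ w d' ws)) , (∧-el₂ ⟫ ≡⇒Pf (sym (atom≡ w d' ws)))))
    where
      ss = rdom₁ R
      atom≡ : ∀ {Δ' Ξ Ξ'} (w : Ren Ξ Ξ') (d' : Δ' ⇒ Ξ') (ws : ∀ {S} → ss ∋ S → Δ' ∋ S) →
          subF (argsSub ss (argVars ss d' ws) w) (rel (oldR R) (tab (map old ss) (λ u → var (inl u))))
          ≡ tr⇒ d' (S₁.rel R (S₁.tab ss (λ v → S₁.var (ws v))))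
      atom≡ w d' ws = cong (rel (oldR R)) (trans (argsSub-vars ss _ w) (sym (trTs⇒-tab ss d' ws)))
  trFormula-sound (rel (defR R) ts) en H γ d lk =
    castEquiv (cong (rel (defR R)) (argsSub-vars ss _ idRen)) refl
      (trTerms-sound ss ts en H γ d lk (rel (defR R) (tab (map old ss) (λ u → var (inl u)))) _
        (λ r w d' c H' hyp ws →
           (∧-el₂ ⟫ ≡⇒Pf (trans (args≡ w d' ws) (sym (axiomAtom≡ d' ws))) ⟫ renPf (unmap (λ v → d' (ws v))) (axiom (ax-rel₁ R)) ⟫ ≡⇒Pf (sym (definition≡ d' ws))) ,
           (∧-el₂ ⟫ ≡⇒Pf (definition≡ d' ws) ⟫ renPf (unmap (λ v → d' (ws v))) (axiom (ax-rel₂ R)) ⟫ ≡⇒Pf (trans (axiomAtom≡ d' ws) (sym (args≡ w d' ws))))))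
    where
      ss = defRelDom R
      args≡ : ∀ {Δ' Ξ Ξ'} (w : Ren Ξ Ξ') (d' : Δ' ⇒ Ξ') (ws : ∀ {S} → ss ∋ S → Δ' ∋ S) →
           subF (argsSub ss (argVars ss d' ws) w) (rel (defR R) (tab (map old ss) (λ u → var (inl u)))) ≡ rel (defR R) (argVars ss d' ws)
      args≡ w d' ws = cong (rel (defR R)) (argsSub-vars ss _ w)
      axiomAtom≡ : ∀ {Δ' Ξ'} (d' : Δ' ⇒ Ξ') (ws : ∀ {S} → ss ∋ S → Δ' ∋ S) →
           renF (unmap (λ v → d' (ws v))) (rel (defR R) (tab (map old ss) var)) ≡ rel (defR R) (argVars ss d' ws)
      axiomAtom≡ d' ws = cong (rel (defR R)) (renTs-tab (map old ss) _ var)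
      definition≡ : ∀ {Δ' Ξ'} (d' : Δ' ⇒ Ξ') (ws : ∀ {S} → ss ∋ S → Δ' ∋ S) →
           tr⇒ d' (S₁.renF ws (defRelFml R)) ≡ renF (unmap (λ v → d' (ws v))) (tr (defRelFml R))
      definition≡ d' ws = trans (tr⇒-renF d' ws (defRelFml R)) (tr⇒≡renF-tr _ (defRelFml R))
  trFormula-sound (_≐_ {X} s t) en H γ d lk =
    castEquiv (cong₂ _≐_ refl (trans (headSub-wkT _ idRen (renT γ t)) (renT-id _))) refl
      (trTerm-sound s en H γ d lk (var here ≐ renT there (renT γ t)) _
        (λ r w d' c H' hyp ra a la →
          castEquiv (sym (cong₂ _≐_ refl (trans (headSub-wkT a w (renT γ t)) (renT-comp w γ t)))) refl
            (castEquiv (cong₂ _≐_ (trans (headSub-wkT _ idRen a) (renT-id a)) refl) refl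
              (trTerm-sound t (renEnv r en) H' (λ v → w (γ v)) d' (LinksHold-ren lk r w d' c H' hyp) (renT there a ≐ var here) _
                (λ r' w' d'' c' H'' hyp' rb b lb →
                  castEquiv (sym (cong₂ _≐_ (headSub-wkT b w' a) refl)) refl
                    (eq⇔RepEq X d'' (renRep X r' ra) rb (renT w' a) b (link-ren X d' r' w' d'' c' hyp' ra a la) lb))))))
  trFormula-sound (∃' {X} φ) en H γ d lk =
    ∃-elimH (∧-intro idt (top ⟫ branch-cover X (var here))
             ⟫ ⋁-elimH (branches X) (trFormula-∃-forward φ (trFormula-sound φ) en H γ d lk)) ,
    castL (cong (H ∧'_) (sym (tr⇒-trFormula-∃ en φ d)))
      (⋁-elimH (branches X) (trFormula-∃-backward φ (trFormula-sound φ) en H γ d lk))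

  -- A branch of a context picks a branch for every variable; branch k of X ∷ Γ is combine i j.
  tupleBranches : Ctx → ℕ
  tupleBranches [] = 1
  tupleBranches (X ∷ Γ) = branches X * tupleBranches Γ

  headBranch : (X : Sort₂) (Γ : Ctx) → Fin (tupleBranches (X ∷ Γ)) → Fin (branches X)
  headBranch X Γ k = proj₁ (remQuot {branches X} (tupleBranches Γ) k)

  tailBranch : (X : Sort₂) (Γ : Ctx) → Fin (tupleBranches (X ∷ Γ)) → Fin (tupleBranches Γ)
  tailBranch X Γ k = proj₂ (remQuot {branches X} (tupleBranches Γ) k)

  tupleCtx : (Γ : Ctx) → Fin (tupleBranches Γ) → S₁.Ctx
  tupleCtx [] k = []
  tupleCtx (X ∷ Γ) k = branchCtx X (headBranch X Γ k) ++ tupleCtx Γ (tailBranch X Γ k)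

  tupleEnv : (Γ : Ctx) (k : Fin (tupleBranches Γ)) → Env Γ (tupleCtx Γ k)
  tupleEnv [] k ()
  tupleEnv (X ∷ Γ) k = extEnv X (headBranch X Γ k) (tupleEnv Γ (tailBranch X Γ k))

  tupleGuard : (Γ : Ctx) (k : Fin (tupleBranches Γ)) → S₁.Formula (tupleCtx Γ k)
  tupleGuard [] k = S₁.⊤'
  tupleGuard (X ∷ Γ) k = S₁.renF inl (branchGuard X (headBranch X Γ k))
                         S₁.∧' S₁.renF (inr (branchCtx X (headBranch X Γ k))) (tupleGuard Γ (tailBranch X Γ k))

  TupleLinks : ∀ {Ξ} (Γ : Ctx) (k : Fin (tupleBranches Γ)) → tupleCtx Γ k ⇒ Ξ → Ren Γ Ξ → Formula Ξ
  TupleLinks Γ k dd γ = ⋀ Γ (λ {X} y → Link dd X (tupleEnv Γ k y) (var (γ y)))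

  links⇒tupleGuard : ∀ {Ξ} (Γ : Ctx) (k : Fin (tupleBranches Γ)) (dd : tupleCtx Γ k ⇒ Ξ) (γ : Ren Γ Ξ) →
                     Pf T₂ Ξ (TupleLinks Γ k dd γ) (tr⇒ dd (tupleGuard Γ k))
  links⇒tupleGuard [] k dd γ = top
  links⇒tupleGuard (X ∷ Γ) k dd γ =
    ∧-intro (∧-el₁ ⟫ ≡⇒Pf (Link-renRep dd inl X (branchRep X i) _) ⟫ link⇒guard X i (λ e → dd (inl e)) _
              ⟫ ≡⇒Pf (sym (tr⇒-renF dd inl (branchGuard X i))))
            (∧-el₂ ⟫ ≡⇒Pf (⋀-cong Γ (λ {Y} y → Link-renRep dd (inr (branchCtx X i)) Y (tupleEnv Γ j y) _))
              ⟫ links⇒tupleGuard Γ j (λ z → dd (inr (branchCtx X i) z)) (λ y → γ (there y))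
              ⟫ ≡⇒Pf (sym (tr⇒-renF dd (inr (branchCtx X i)) (tupleGuard Γ j))))
    where i = headBranch X Γ k
          j = tailBranch X Γ k

  tuple-exists : ∀ {Ξ} (Γ : Ctx) (k : Fin (tupleBranches Γ)) (dd : tupleCtx Γ k ⇒ Ξ) →
                 Pf T₂ Ξ (tr⇒ dd (tupleGuard Γ k)) (∃* Γ (TupleLinks Γ k (λ z → inr Γ (dd z)) inl))
  tuple-exists [] k dd = top
  tuple-exists {Ξ} (X ∷ Γ) k dd =
    ∧-intro idt (∧-el₂ ⟫ ≡⇒Pf (tr⇒-renF dd (inr (branchCtx X i)) (tupleGuard Γ j)) ⟫ tuple-exists Γ j (λ z → dd (inr (branchCtx X i) z)))
    ⟫ ∃*-elimH Γ (∧-intro idt (∧-el₁ ⟫ ∧-el₁ ⟫ ≡⇒Pf guard≡ ⟫ branch-exists X i (λ e → inr Γ (dd (inl e))))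
                  ⟫ ∃-elimH (links ⟫ ∃*-intro (X ∷ Γ) {B = TupleLinks (X ∷ Γ) k ddX inl} ⟫ ≡⇒Pf (sym (renF-comp there (inr Γ) _))))
    where
      i = headBranch X Γ k
      j = tailBranch X Γ k
      ddX : tupleCtx (X ∷ Γ) k ⇒ ((X ∷ Γ) ++ Ξ)
      ddX z = inr (X ∷ Γ) (dd z)
      guard≡ : renF (inr Γ) (tr⇒ dd (S₁.renF inl (branchGuard X i))) ≡ tr⇒ (λ e → inr Γ (dd (inl e))) (branchGuard X i)
      guard≡ = trans (cong (renF (inr Γ)) (tr⇒-renF dd inl (branchGuard X i))) (renF-tr⇒ (inr Γ) _ (branchGuard X i))
      links = ⋀-intro (X ∷ Γ) {f = λ {Y} y → Link ddX Y (tupleEnv (X ∷ Γ) k y) (var (inl y))}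
               (λ { here → ∧-el₂ ⟫ ≡⇒Pf (sym (Link-renRep ddX inl X (branchRep X i) (var here)))
                  ; {Y} (there y) → ∧-el₁ ⟫ ∧-el₂ ⟫ ≡⇒Pf (⋀-ren there Γ _) ⟫ ⋀-elim Γ y ⟫ ≡⇒Pf (Link-ren there _ Y _ _)
                                      ⟫ ≡⇒Pf (sym (Link-renRep ddX (inr (branchCtx X i)) Y (tupleEnv Γ j y) _)) })

  TupleCover : ∀ {Ξ} (Γ : Ctx) → Ren Γ Ξ → Formula Ξ
  TupleCover Γ γ = ⋁ (tupleBranches Γ) (λ k → ∃* (map old (tupleCtx Γ k)) (TupleLinks Γ k (inl⇒ (tupleCtx Γ k)) (λ y → inr _ (γ y))))

  tuple-cover-cons : ∀ {Ξ} (X : Sort₂) (Γ : Ctx) (γ : Ren (X ∷ Γ) Ξ) (i : Fin (branches X)) (j : Fin (tupleBranches Γ)) →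
                     let Ej = map old (tupleCtx Γ j) ; Ei = map old (branchCtx X i) in
                     Pf T₂ (Ej ++ Ei ++ Ξ)
                       (renF (inr Ej) (⊤' ∧' BranchLink X (var (γ here)) i)
                        ∧' TupleLinks Γ j (inl⇒ (tupleCtx Γ j)) (λ y → inr Ej (inr Ei (γ (there y)))))
                       (renF (inr Ej) (renF (inr Ei) (TupleCover (X ∷ Γ) γ)))
  tuple-cover-cons {Ξ} X Γ γ i j =
    links ⟫ ≡⇒Pf (sym links≡) ⟫ ∃*-intro-ren ys Bij c w
    ⟫ renPf w (≡⇒Pf (cong G (sym (remQuot-combine i j))) ⟫ ⋁-intro (tupleBranches (X ∷ Γ)) (combine i j))
    ⟫ ≡⇒Pf (sym (renF-comp (inr Ej) (inr Ei) (TupleCover (X ∷ Γ) γ)))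
    where
      Ej = map old (tupleCtx Γ j)
      Ei = map old (branchCtx X i)
      ys = map old (branchCtx X i ++ tupleCtx Γ j)
      G : Fin (branches X) × Fin (tupleBranches Γ) → Formula Ξ
      G (i' , j') = ∃* (map old (branchCtx X i' ++ tupleCtx Γ j'))
                      (⋀ (X ∷ Γ) (λ {Y} y → Link (inl⇒ (branchCtx X i' ++ tupleCtx Γ j')) Y
                                                (extEnv X i' (tupleEnv Γ j') y) (var (inr _ (γ y)))))
      e₁ : branchCtx X i ⇒ (Ej ++ Ei ++ Ξ)
      e₁ x = inr Ej (inl (mapVar old x))
      e₂ : tupleCtx Γ j ⇒ (Ej ++ Ei ++ Ξ)
      e₂ z = inl (mapVar old z)
      DD = copair⇒ (branchCtx X i) e₁ e₂
      w : Ren Ξ (Ej ++ Ei ++ Ξ)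
      w v = inr Ej (inr Ei v)
      c = unmap DD
      fB : ∀ {Y} → (X ∷ Γ) ∋ Y → Formula (ys ++ Ξ)
      fB {Y} y = Link (inl⇒ (branchCtx X i ++ tupleCtx Γ j)) Y (extEnv X i (tupleEnv Γ j) y) (var (inr ys (γ y)))
      Bij = ⋀ (X ∷ Γ) fB
      links≡ : renF (copair ys c w) Bij ≡ ⋀ (X ∷ Γ) (λ {Y} y → Link DD Y (extEnv X i (tupleEnv Γ j) y) (var (w (γ y))))
      links≡ = trans (⋀-ren (copair ys c w) (X ∷ Γ) fB) (⋀-cong (X ∷ Γ) (λ {Y} y →
              trans (Link-ren (copair ys c w) _ Y _ _)
                (trans (Link-cong (λ z → trans (copair-inl ys c w (mapVar old z)) (unmap-mapVar DD z)) Y _ _)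
                       (cong (λ u → Link DD Y (extEnv X i (tupleEnv Γ j) y) (var u)) (copair-inr ys c w (γ y))))))
      links = ⋀-intro (X ∷ Γ) {f = λ {Y} y → Link DD Y (extEnv X i (tupleEnv Γ j) y) (var (w (γ y)))}
               (λ { here → ∧-el₁ ⟫ ∧-el₂ ⟫ ∧-el₂ ⟫ ≡⇒Pf (Link-ren (inr Ej) (inl⇒ (branchCtx X i)) X (branchRep X i) _)
                           ⟫ ≡⇒Pf (sym (trans (Link-renRep DD inl X (branchRep X i) _)
                                              (Link-cong (copair⇒-inl (branchCtx X i) e₁ e₂) X (branchRep X i) _)))
                  ; {Y} (there y) → ∧-el₂ ⟫ ⋀-elim Γ y
                           ⟫ ≡⇒Pf (sym (trans (Link-renRep DD (inr (branchCtx X i)) Y (tupleEnv Γ j y) _)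
                                              (Link-cong (copair⇒-inr (branchCtx X i) e₁ e₂) Y (tupleEnv Γ j y) _))) })

  tuple-cover : ∀ {Ξ} (Γ : Ctx) (γ : Ren Γ Ξ) → Pf T₂ Ξ ⊤' (TupleCover Γ γ)
  tuple-cover [] γ = top ⟫ ∨-in₁
  tuple-cover (X ∷ Γ) γ =
    ∧-intro idt (branch-cover X (var (γ here))) ⟫ ⋁-elimH (branches X) (λ i → ∃*-elimH (map old (branchCtx X i))
      (∧-intro idt (top ⟫ tuple-cover Γ (λ y → inr (map old (branchCtx X i)) (γ (there y))))
       ⟫ ⋁-elimH (tupleBranches Γ) (λ j → ∃*-elimH (map old (tupleCtx Γ j)) (tuple-cover-cons X Γ γ i j))))

  module BranchGraphs (ys : Ctx) (ψ : Formula ys) where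
    branchFormula : (k : Fin (tupleBranches ys)) → S₁.Formula (tupleCtx ys k)
    branchFormula k = tupleGuard ys k S₁.∧' trFormula (tupleEnv ys k) ψ

    tupleVars⇒ : (k : Fin (tupleBranches ys)) → tupleCtx ys k ⇒ (ys ++ map old (tupleCtx ys k))
    tupleVars⇒ k z = inr ys (mapVar old z)

    graphLinks : (k : Fin (tupleBranches ys)) → Formula (ys ++ map old (tupleCtx ys k))
    graphLinks k = TupleLinks ys k (tupleVars⇒ k) inl

    branchGraph : (k : Fin (tupleBranches ys)) → Formula (ys ++ map old (tupleCtx ys k))
    branchGraph k = renF inl ψ ∧' graphLinks k

    graphLinks-sound : (k : Fin (tupleBranches ys)) →
                       Equiv (graphLinks k) (renF inl ψ) (tr⇒ (tupleVars⇒ k) (trFormula (tupleEnv ys k) ψ))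
    graphLinks-sound k = trFormula-sound ψ (tupleEnv ys k) (graphLinks k) inl (tupleVars⇒ k) (λ y → ⋀-elim ys y)

    tr-branchFormula : (k : Fin (tupleBranches ys)) →
                       renF (inr ys) (tr (branchFormula k)) ≡ tr⇒ (tupleVars⇒ k) (branchFormula k)
    tr-branchFormula k = trans (cong (renF (inr ys)) (tr≡tr⇒ (branchFormula k))) (renF-tr⇒ (inr ys) (mapVar old) (branchFormula k))

    branchGraph-graph : (k : Fin (tupleBranches ys)) →
                        Pf T₂ (ys ++ map old (tupleCtx ys k)) (branchGraph k)
                          (renF (inr ys) (tr (branchFormula k)) ∧' renF inl ψ)
    branchGraph-graph k =
      ∧-intro (castR (sym (tr-branchFormula k))
                (∧-intro (∧-el₂ ⟫ links⇒tupleGuard ys k (tupleVars⇒ k) inl)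
                         (∧-intro ∧-el₂ ∧-el₁ ⟫ proj₁ (graphLinks-sound k))))
              ∧-el₁

    branchGraph-total : (k : Fin (tupleBranches ys)) →
                        Pf T₂ (map old (tupleCtx ys k)) (tr (branchFormula k)) (∃* ys (branchGraph k))
    branchGraph-total k =
      castL (sym (tr≡tr⇒ (branchFormula k)))
        (∧-intro idt (∧-el₁ ⟫ tuple-exists ys k (mapVar old)) ⟫
         ∃*-elimH ys (∧-intro (∧-intro ∧-el₂ (∧-el₁ ⟫ ≡⇒Pf (renF-tr⇒ (inr ys) (mapVar old) (branchFormula k)) ⟫ ∧-el₂)
                                ⟫ proj₂ (graphLinks-sound k))
                              ∧-el₂
                      ⟫ ∃*-intro ys {branchGraph k}))

    branchGraph-unique : (k : Fin (tupleBranches ys)) → let xs = map old (tupleCtx ys k) in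
                         Pf T₂ (ys ++ (ys ++ xs))
                           (renF (copair ys inl (λ v → inr ys (inr ys v))) (branchGraph k) ∧' renF (inr ys) (branchGraph k))
                           (VarsEq ys inl (λ v → inr ys (inl v)))
    branchGraph-unique k =
      ⋀-intro ys (λ {Y} y → link-unique Y dU (tupleEnv ys k y) (var (inl y)) (var (inr ys (inl y)))
        (∧-el₁ ⟫ ∧-el₂ ⟫ ≡⇒Pf (⋀-ren c₁ ys _) ⟫ ⋀-elim ys y
           ⟫ ≡⇒Pf (trans (Link-ren c₁ (tupleVars⇒ k) Y _ _)
                   (trans (Link-cong (λ z → copair-inr ys inl _ (mapVar old z)) Y _ _)
                          (cong (λ u → Link dU Y (tupleEnv ys k y) (var u)) (copair-inl ys inl _ y)))))
        (∧-el₂ ⟫ ∧-el₂ ⟫ ≡⇒Pf (⋀-ren (inr ys) ys _) ⟫ ⋀-elim ys y ⟫ ≡⇒Pf (Link-ren (inr ys) (tupleVars⇒ k) Y _ _)))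
      where
        xs = map old (tupleCtx ys k)
        c₁ : Ren (ys ++ xs) (ys ++ (ys ++ xs))
        c₁ = copair ys inl (λ v → inr ys (inr ys v))
        dU : tupleCtx ys k ⇒ (ys ++ (ys ++ xs))
        dU z = inr ys (inr ys (mapVar old z))

    branchGraph-provFun : (k : Fin (tupleBranches ys)) → ProvFun T₂ (tr (branchFormula k)) ψ (branchGraph k)
    branchGraph-provFun k = record { pf-graph  = branchGraph-graph k
                                   ; pf-total  = branchGraph-total k
                                   ; pf-unique = branchGraph-unique k }

    swap-branchGraph : (k : Fin (tupleBranches ys)) → let zs = map old (tupleCtx ys k) in
                       renF (swap ys zs) (branchGraph k)
                         ≡ (renF (inr zs) ψ ∧' TupleLinks ys k (inl⇒ (tupleCtx ys k)) (λ y → inr zs (idRen y)))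
    swap-branchGraph k =
      cong₂ _∧'_
        (trans (renF-comp _ inl ψ) (renF-cong (copair-inl ys (inr zs) inl) ψ))
        (trans (⋀-ren (swap ys zs) ys _) (⋀-cong ys (λ {Y} y →
           trans (Link-ren (swap ys zs) (tupleVars⇒ k) Y _ _)
             (trans (Link-cong (λ z → copair-inr ys (inr zs) inl (mapVar old z)) Y _ _)
                    (cong (λ u → Link (inl⇒ (tupleCtx ys k)) Y (tupleEnv ys k y) (var u)) (copair-inl ys (inr zs) inl y))))))
      where zs = map old (tupleCtx ys k)

    branchGraphs-cover : Pf T₂ ys ψ (⋁ (tupleBranches ys) (λ k →
                           ∃* (map old (tupleCtx ys k)) (renF (swap ys (map old (tupleCtx ys k))) (branchGraph k))))
    branchGraphs-cover =
      ∧-intro idt (top ⟫ tuple-cover ys idRen) ⟫ ⋁-elimH (tupleBranches ys) (λ k →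
        ∃*-elimH (map old (tupleCtx ys k))
          (≡⇒Pf (sym (swap-branchGraph k)) ⟫ ∃*-intro (map old (tupleCtx ys k))
            ⟫ renPf (inr (map old (tupleCtx ys k))) (⋁-intro (tupleBranches ys) k)))

proposition3p9 : {Σ₁ : Signature} {T₁ : Syntax.Theory Σ₁} (M : MoritaData T₁) →
    let open Ext M in
    (ys : S₂.Ctx) (ψ : S₂.Formula ys) →
    Σ ℕ λ n →
    Σ (Fin n → S₁.Ctx) λ zs →
    Σ ((k : Fin n) → S₁.Formula (zs k)) λ χ →
    Σ ((k : Fin n) → S₂.Formula (ys ++ map old (zs k))) λ θ →
    ((k : Fin n) → S₂.ProvFun T₂ (tr (χ k)) ψ (θ k))
    × S₂.Pf T₂ ys ψ
    (S₂.⋁ n (λ k → S₂.∃* (map old (zs k)) (S₂.renF (swap ys (map old (zs k))) (θ k))))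
proposition3p9 M ys ψ =
  tupleBranches ys , tupleCtx ys , branchFormula , branchGraph , branchGraph-provFun , branchGraphs-cover
  where
    open MoritaTranslation M
    open BranchGraphs ys ψ
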